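{- For $\tau$ in the upper half-plane, $$G(2)\,H(1) - G(1)\,H(2) = \frac{\eta(\tau)\eta(4\tau)\eta(6\tau)}{\eta(2\tau)\eta(12\tau)^{2}},$$ where $G(n)=1/\eta_{12;1}(n\tau)$ and $H(n)=1/\eta_{12;5}(n\tau)$.
   Context: $q=e^{2\pi i\tau}$, $\eta(\tau)=q^{1/24}\prod_{n\ge1}(1-q^n)$. With $P_2(t)=\{t\}^2-\{t\}+\tfrac16$ ($\{t\}$ the fractional part), for $0<g<\delta$ and a positive integer $n$, $\eta_{\delta;g}(n\tau)=q^{\frac{n\delta}{2}P_2(g/\delta)}\prod_{m\ge1,\ m\equiv \pm g \pmod \delta}(1-q^{nm})$. -}

module Defs where

-- Formal (q-expansion) framework for eta quotients.
-- All objects are formal Laurent series in x = q^(1/D) with integer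
-- coefficients, where D is a positive integer fixed per statement.

open import Data.Bool using (Bool; true; false; if_then_else_; _∨_)
open import Data.Nat as ℕ using (ℕ; zero; suc; _∸_; _≡ᵇ_; NonZero)
open import Data.Nat.Properties using (m*n≢0)
open import Data.Integer as ℤ using (ℤ; +_; -[1+_]; _+_; _*_; _-_; -_)
open import Relation.Binary.PropositionalEquality using (_≡_)

PS : Set
PS = ℕ → ℤ

sumTo : (ℕ → ℤ) → ℕ → ℤ
sumTo f zero    = f 0
sumTo f (suc n) = sumTo f n + f (suc n)

_⊛_ : PS → PS → PS
(a ⊛ b) n = sumTo (λ k → a k * b (n ∸ k)) n

oneP : PS
oneP zero    = + 1
oneP (suc _) = + 0

factor : ℕ → PS
factor c n = (if n ≡ᵇ 0 then + 1 else + 0) - (if n ≡ᵇ c then + 1 else + 0)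

finProd : (ℕ → Bool) → (ℕ → ℕ) → ℕ → PS
finProd S e zero    = oneP
finProd S e (suc K) =
  if S (suc K) then finProd S e K ⊛ factor (e (suc K)) else finProd S e K

-- infinite product  Π_{m ≥ 1, S m} (1 - x^(e m)), as a formal power series.
-- Valid whenever e m ≥ m for all m ≥ 1 (as for e m = n·m with n ≥ 1):
-- factors with m > N do not affect the coefficient of x^N.
infProd : (ℕ → Bool) → (ℕ → ℕ) → PS
infProd S e N = finProd S e N N

-- multiplicative inverse of a power series whose constant term is a unit
-- (±1) in ℤ:  b 0 = a 0,  b (N+1) = - a 0 · Σ_{j=1}^{N+1} a j · b (N+1-j).
invUpTo : PS → ℕ → (ℕ → ℤ)
invUpTo a zero    = λ _ → a 0
invUpTo a (suc N) = λ k → if k ≡ᵇ suc N then new else b k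
  where
    b : ℕ → ℤ
    b = invUpTo a N
    new : ℤ
    new = - (a 0 * sumTo (λ k → a (suc k) * b (N ∸ k)) N)

invPS : PS → PS
invPS a n = invUpTo a n n

spread : (D : ℕ) .{{_ : NonZero D}} → PS → PS
spread D a n = if (n ℕ.% D) ≡ᵇ 0 then a (n ℕ./ D) else + 0

-- Formal Laurent series  x^val · Σ_{n≥0} ser n · x^n
record LS : Set where
  constructor mkLS
  field
    val : ℤ
    ser : PS
open LS public

coeffAt : LS → ℤ → ℤ
coeffAt L k with k - val L
... | + m     = ser L m
... | -[1+ _ ] = + 0

_⊗_ : LS → LS → LS
A ⊗ B = mkLS (val A + val B) (ser A ⊛ ser B)

_⊖_ : LS → LS → LS
A ⊖ B = mkLS v (λ n → coeffAt A (v + + n) - coeffAt B (v + + n))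
  where
    v : ℤ
    v = val A ℤ.⊓ val B

-- inverse of x^v·F with F(0) = ±1
invLS : LS → LS
invLS L = mkLS (- val L) (invPS (ser L))

_≈_ : LS → LS → Set
A ≈ B = ∀ k → coeffAt A k ≡ coeffAt B k

infixl 7 _⊗_
infixl 6 _⊖_
infix 4 _≈_

-- Dedekind eta  η(nτ) = q^(n/24) Π_{m≥1} (1 - q^(n m)),
-- expanded in x = q^(1/(24 k)) (so q = x^(24k), q^(n/24) = x^(n k)).
etaLS : (k : ℕ) .{{_ : NonZero k}} → (n : ℕ) → LS
etaLS k n = mkLS (+ (n ℕ.* k))
  (spread (24 ℕ.* k) {{m*n≢0 24 k}} (infProd (λ _ → true) (λ m → n ℕ.* m)))

-- Generalized eta  η_{δ;g}(nτ) = q^((nδ/2) P₂(g/δ)) Π_{m≥1, m ≡ ±g (mod δ)} (1 - q^(n m)),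
-- expanded in x = q^(1/(24 δ)).  For 0 < g < δ we have {g/δ} = g/δ, so
-- (nδ/2) P₂(g/δ) = n (6g² - 6gδ + δ²) / (12 δ), i.e. the exponent of x is
-- 2n(6g² - 6gδ + δ²)  (an integer).
etaGen : (δ : ℕ) .{{_ : NonZero δ}} → (g n : ℕ) → LS
etaGen δ g n = mkLS
  (+ (2 ℕ.* n ℕ.* (6 ℕ.* g ℕ.* g ℕ.+ δ ℕ.* δ)) - + (2 ℕ.* n ℕ.* (6 ℕ.* g ℕ.* δ)))
  (spread (24 ℕ.* δ) {{m*n≢0 24 δ}} (infProd S (λ m → n ℕ.* m)))
  where
    S : ℕ → Bool
    S m = ((m ℕ.% δ) ≡ᵇ g) ∨ ((m ℕ.% δ) ≡ᵇ (δ ∸ g))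

G : ℕ → LS
G n = invLS (etaGen 12 1 n)

H : ℕ → LS
H n = invLS (etaGen 12 5 n)

η : ℕ → LS
η n = etaLS 12 n

{-# OPTIONS --safe #-}
-- Work with power series in x = q^(1/288) over ℤ, and write E_c = (q^c; q^c)_∞ and
-- P_g(q^c) = ∏_{m ≡ ±g (mod 12)} (1 - q^(cm)). Clearing denominators and the common leading power
-- of q, the theorem becomes
--     E₁ P₁ P₅ + q P₁(q²) P₅ E₁₂ = P₅(q²) P₁ E₁₂
-- once E₄ E₆ P₁(q²) P₅(q²) = E₂ E₁₂ is known; both sides of the latter are ∏ (1 - q^d)^(μ d) with
-- the same 24-periodic multiplicities μ. The Jacobi triple product gives E₁ = Σ_t (-1)^t q^(t(3t-1)/2)
-- and P_g(q²) E₁₂ = θ_g P_g with θ_g = Σ_t q^(6t² - (6-g)t), and splitting the pentagonal series by the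
-- parity of t gives E₁ + q θ₁ = θ₅, which is the identity above. The triple product itself follows
-- from the q-binomial theorem for ∏_{i < 2n} (x^w + s q^i): multiplied by (q; q)_∞, the Gaussian
-- coefficient [2n, j] is 1 below degree min(j, 2n - j), so near its centre the expansion is a theta series.

module Submission where

open import Defs
open import Algebra.Bundles using (CommutativeMonoid; CommutativeRing; Ring)
import Algebra.Properties.CommutativeSemigroup as CommutativeSemigroupProperties
open import Algebra.Solver.Ring.AlmostCommutativeRing using (fromCommutativeRing; _-Raw-AlmostCommutative⟶_)
open import Algebra.Structures using (IsCommutativeMonoid)
open import Data.Bool using (Bool; true; false; if_then_else_; _∧_; _∨_)
open import Data.Empty using (⊥-elim)
open import Data.Fin as Fin using (Fin)
import Data.Fin.Properties as FinP
open import Data.Integer as ℤ using (ℤ; +_; -[1+_]; _+_; _*_; _-_; -_)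
import Data.Integer.Properties as ℤP
import Data.Integer.Tactic.RingSolver as ℤ-Solver
open import Data.Maybe using (Maybe; just; nothing)
open import Data.Nat as ℕ using (ℕ; zero; suc; _∸_; _≡ᵇ_; NonZero; z≤n; s≤s)
import Data.Nat.DivMod as DM
open import Data.Nat.Divisibility using (divides)
import Data.Nat.Properties as ℕP
import Data.Nat.Tactic.RingSolver as ℕ-Solver
open import Data.Product using (_,_)
open import Data.Sum using (_⊎_; inj₁; inj₂)
open import Function using (_∘_)
open import Level using (0ℓ)
open import Relation.Binary.Bundles using (Setoid)
open import Relation.Binary.PropositionalEquality
import Relation.Binary.Reasoning.Setoid as SetoidReasoning
open import Relation.Nullary using (yes; no)
open import Relation.Nullary.Decidable using (toWitness)

private
  module ℤ+ = CommutativeSemigroupProperties ℤP.+-commutativeSemigroup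

-- The ring of power series

sumTo-cong-≤ : ∀ {f g : ℕ → ℤ} n → (∀ k → k ℕ.≤ n → f k ≡ g k) → sumTo f n ≡ sumTo g n
sumTo-cong-≤ zero    f≡g = f≡g 0 z≤n
sumTo-cong-≤ (suc n) f≡g =
  cong₂ _+_ (sumTo-cong-≤ n (λ k k≤n → f≡g k (ℕP.m≤n⇒m≤1+n k≤n))) (f≡g (suc n) ℕP.≤-refl)

sumTo-cong : ∀ {f g : ℕ → ℤ} n → f ≗ g → sumTo f n ≡ sumTo g n
sumTo-cong n f≗g = sumTo-cong-≤ n (λ k _ → f≗g k)

sumTo-+ : ∀ (f g : ℕ → ℤ) n → sumTo (λ k → f k + g k) n ≡ sumTo f n + sumTo g n
sumTo-+ f g zero    = refl
sumTo-+ f g (suc n) rewrite sumTo-+ f g n = ℤ+.interchange (sumTo f n) (sumTo g n) (f (suc n)) (g (suc n))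

sumTo-*ˡ : ∀ c (f : ℕ → ℤ) n → sumTo (λ k → c * f k) n ≡ c * sumTo f n
sumTo-*ˡ c f zero    = refl
sumTo-*ˡ c f (suc n) rewrite sumTo-*ˡ c f n = sym (ℤP.*-distribˡ-+ c (sumTo f n) (f (suc n)))

sumTo-zero : ∀ n → sumTo (λ _ → + 0) n ≡ + 0
sumTo-zero zero    = refl
sumTo-zero (suc n) rewrite sumTo-zero n = refl

sumTo-unfoldˡ : ∀ (f : ℕ → ℤ) n → sumTo f (suc n) ≡ f 0 + sumTo (f ∘ suc) n
sumTo-unfoldˡ f zero    = refl
sumTo-unfoldˡ f (suc n) rewrite sumTo-unfoldˡ f n = ℤP.+-assoc (f 0) _ _

sumTo-reverse : ∀ (f : ℕ → ℤ) n → sumTo f n ≡ sumTo (λ k → f (n ∸ k)) n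
sumTo-reverse f zero    = refl
sumTo-reverse f (suc n) = begin
  sumTo f n + f (suc n)                   ≡⟨ cong (_+ f (suc n)) (sumTo-reverse f n) ⟩
  sumTo (λ k → f (n ∸ k)) n + f (suc n)   ≡⟨ ℤP.+-comm _ (f (suc n)) ⟩
  f (suc n) + sumTo (λ k → f (n ∸ k)) n   ≡⟨ sym (sumTo-unfoldˡ (λ k → f (suc n ∸ k)) n) ⟩
  sumTo (λ k → f (suc n ∸ k)) (suc n)     ∎
  where open ≡-Reasoning

sumTo-triangle : ∀ (g : ℕ → ℕ → ℤ) n →
  sumTo (λ k → sumTo (λ j → g j k) k) n ≡ sumTo (λ j → sumTo (λ i → g j (j ℕ.+ i)) (n ∸ j)) n
sumTo-triangle g zero    = refl
sumTo-triangle g (suc n) = begin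
  sumTo (λ k → sumTo (λ j → g j k) k) n + sumTo (λ j → g j (suc n)) (suc n)
    ≡⟨ cong (_+ sumTo (λ j → g j (suc n)) (suc n)) (sumTo-triangle g n) ⟩
  rows n + (sumTo (λ j → g j (suc n)) n + g (suc n) (suc n))
    ≡⟨ sym (ℤP.+-assoc (rows n) _ _) ⟩
  rows n + sumTo (λ j → g j (suc n)) n + g (suc n) (suc n)
    ≡⟨ cong (_+ g (suc n) (suc n)) (sym (sumTo-+ _ _ n)) ⟩
  sumTo (λ j → row j (n ∸ j) + g j (suc n)) n + g (suc n) (suc n)
    ≡⟨ cong₂ _+_ (sumTo-cong-≤ n extend-row) (cong (g (suc n)) (sym (ℕP.+-identityʳ (suc n)))) ⟩
  sumTo (λ j → row j (suc n ∸ j)) n + g (suc n) (suc n ℕ.+ 0)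
    ≡⟨ cong (λ z → sumTo (λ j → row j (suc n ∸ j)) n + row (suc n) z) (sym (ℕP.n∸n≡0 (suc n))) ⟩
  sumTo (λ j → row j (suc n ∸ j)) (suc n) ∎
  where
  open ≡-Reasoning
  row : ℕ → ℕ → ℤ
  row j = sumTo (λ i → g j (j ℕ.+ i))
  rows : ℕ → ℤ
  rows n = sumTo (λ j → row j (n ∸ j)) n
  extend-row : ∀ j → j ℕ.≤ n → row j (n ∸ j) + g j (suc n) ≡ row j (suc n ∸ j)
  extend-row j j≤n rewrite ℕP.+-∸-assoc 1 j≤n =
    cong (λ z → row j (n ∸ j) + z) (cong (g j) (sym (trans (ℕP.+-suc j (n ∸ j)) (cong suc (ℕP.m+[n∸m]≡n j≤n)))))

infixl 6 _+ₚ_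

_+ₚ_ : PS → PS → PS
(a +ₚ b) n = a n + b n

-ₚ_ : PS → PS
(-ₚ a) n = - a n

zeroP : PS
zeroP _ = + 0

+ₚ-cong : ∀ {a a′ b b′} → a ≗ a′ → b ≗ b′ → a +ₚ b ≗ a′ +ₚ b′
+ₚ-cong a≗a′ b≗b′ n = cong₂ _+_ (a≗a′ n) (b≗b′ n)

+ₚ-congˡ : ∀ a {b b′} → b ≗ b′ → a +ₚ b ≗ a +ₚ b′
+ₚ-congˡ a b≗b′ n = cong (λ z → a n + z) (b≗b′ n)

+ₚ-congʳ : ∀ {a a′} b → a ≗ a′ → a +ₚ b ≗ a′ +ₚ b
+ₚ-congʳ b a≗a′ n = cong (_+ b n) (a≗a′ n)

+ₚ-assoc : ∀ a b c → (a +ₚ b) +ₚ c ≗ a +ₚ (b +ₚ c)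
+ₚ-assoc a b c n = ℤP.+-assoc (a n) (b n) (c n)

+ₚ-comm : ∀ a b → a +ₚ b ≗ b +ₚ a
+ₚ-comm a b n = ℤP.+-comm (a n) (b n)

+ₚ-identityˡ : ∀ a → zeroP +ₚ a ≗ a
+ₚ-identityˡ a n = ℤP.+-identityˡ (a n)

⊛-cong : ∀ {a a′ b b′} → a ≗ a′ → b ≗ b′ → a ⊛ b ≗ a′ ⊛ b′
⊛-cong a≗a′ b≗b′ n = sumTo-cong n (λ k → cong₂ _*_ (a≗a′ k) (b≗b′ (n ∸ k)))

⊛-comm : ∀ a b → a ⊛ b ≗ b ⊛ a
⊛-comm a b n = trans (sumTo-reverse _ n) (sumTo-cong-≤ n (λ k k≤n →
  trans (cong (λ z → a (n ∸ k) * b z) (ℕP.m∸[m∸n]≡n k≤n)) (ℤP.*-comm (a (n ∸ k)) (b k))))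

⊛-assoc : ∀ a b c → (a ⊛ b) ⊛ c ≗ a ⊛ (b ⊛ c)
⊛-assoc a b c n = begin
  sumTo (λ k → sumTo (λ j → a j * b (k ∸ j)) k * c (n ∸ k)) n
    ≡⟨ sumTo-cong n (λ k → trans (ℤP.*-comm _ (c (n ∸ k)))
         (trans (sym (sumTo-*ˡ (c (n ∸ k)) _ k)) (sumTo-cong k (λ j → ℤP.*-comm (c (n ∸ k)) _)))) ⟩
  sumTo (λ k → sumTo (λ j → a j * b (k ∸ j) * c (n ∸ k)) k) n
    ≡⟨ sumTo-triangle (λ j k → a j * b (k ∸ j) * c (n ∸ k)) n ⟩
  sumTo (λ j → sumTo (λ i → a j * b (j ℕ.+ i ∸ j) * c (n ∸ (j ℕ.+ i))) (n ∸ j)) n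
    ≡⟨ sumTo-cong n (λ j → trans (sumTo-cong (n ∸ j) (λ i →
         trans (cong₂ (λ u v → a j * b u * c v) (ℕP.m+n∸m≡n j i) (sym (ℕP.∸-+-assoc n j i)))
               (ℤP.*-assoc (a j) _ _)))
         (sumTo-*ˡ (a j) _ (n ∸ j))) ⟩
  sumTo (λ j → a j * sumTo (λ i → b i * c (n ∸ j ∸ i)) (n ∸ j)) n ∎
  where open ≡-Reasoning

⊛-distribˡ : ∀ a b c → a ⊛ (b +ₚ c) ≗ (a ⊛ b) +ₚ (a ⊛ c)
⊛-distribˡ a b c n =
  trans (sumTo-cong n (λ k → ℤP.*-distribˡ-+ (a k) (b (n ∸ k)) (c (n ∸ k)))) (sumTo-+ _ _ n)

⊛-distribʳ : ∀ a b c → (b +ₚ c) ⊛ a ≗ (b ⊛ a) +ₚ (c ⊛ a)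
⊛-distribʳ a b c n =
  trans (sumTo-cong n (λ k → ℤP.*-distribʳ-+ (a (n ∸ k)) (b k) (c k))) (sumTo-+ _ _ n)

⊛-zeroˡ : ∀ a → zeroP ⊛ a ≗ zeroP
⊛-zeroˡ a n = trans (sumTo-cong n (λ k → ℤP.*-zeroˡ (a (n ∸ k)))) (sumTo-zero n)

⊛-identityˡ : ∀ a → oneP ⊛ a ≗ a
⊛-identityˡ a zero    = ℤP.*-identityˡ (a 0)
⊛-identityˡ a (suc n) = begin
  sumTo (λ k → oneP k * a (suc n ∸ k)) (suc n)       ≡⟨ sumTo-unfoldˡ _ n ⟩
  + 1 * a (suc n) + sumTo (λ k → + 0 * a (n ∸ k)) n  ≡⟨ cong₂ _+_ (ℤP.*-identityˡ (a (suc n))) (⊛-zeroˡ a n) ⟩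
  a (suc n) + + 0                                    ≡⟨ ℤP.+-identityʳ _ ⟩
  a (suc n)                                          ∎
  where open ≡-Reasoning

⊛-identityʳ : ∀ a → a ⊛ oneP ≗ a
⊛-identityʳ a n = trans (⊛-comm a oneP n) (⊛-identityˡ a n)

PS-commutativeRing : CommutativeRing 0ℓ 0ℓ
PS-commutativeRing = record
  { Carrier = PS ; _≈_ = _≗_ ; _+_ = _+ₚ_ ; _*_ = _⊛_ ; -_ = -ₚ_ ; 0# = zeroP ; 1# = oneP
  ; isCommutativeRing = record
    { isRing = record
      { +-isAbelianGroup = record
        { isGroup = record
          { isMonoid = record
            { isSemigroup = record
              { isMagma = record
                { isEquivalence = Setoid.isEquivalence (ℕ →-setoid ℤ)
                ; ∙-cong = +ₚ-cong }
              ; assoc = +ₚ-assoc }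
            ; identity = +ₚ-identityˡ , (λ a n → ℤP.+-identityʳ (a n)) }
          ; inverse = (λ a n → ℤP.+-inverseˡ (a n)) , (λ a n → ℤP.+-inverseʳ (a n))
          ; ⁻¹-cong = λ a≗b n → cong -_ (a≗b n) }
        ; comm = +ₚ-comm }
      ; *-cong = ⊛-cong
      ; *-assoc = ⊛-assoc
      ; *-identity = ⊛-identityˡ , ⊛-identityʳ
      ; distrib = ⊛-distribˡ , ⊛-distribʳ }
    ; *-comm = ⊛-comm } }

module ≗-Reasoning = SetoidReasoning (CommutativeRing.setoid PS-commutativeRing)
open CommutativeRing PS-commutativeRing using () renaming (sym to ≗-sym; trans to ≗-trans)

private
  module ⊛ = CommutativeSemigroupProperties (CommutativeRing.*-commutativeSemigroup PS-commutativeRing)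

⊛-congʳ : ∀ {a b} c → a ≗ b → a ⊛ c ≗ b ⊛ c
⊛-congʳ c a≗b n = sumTo-cong n (λ k → cong (_* c (n ∸ k)) (a≗b k))

⊛-congˡ : ∀ c {a b} → a ≗ b → c ⊛ a ≗ c ⊛ b
⊛-congˡ c a≗b n = sumTo-cong n (λ k → cong (c k *_) (a≗b (n ∸ k)))

+ₚ-identityʳ-≗ : ∀ a {b} → b ≗ zeroP → a +ₚ b ≗ a
+ₚ-identityʳ-≗ a b≗0 n = trans (cong (λ z → a n + z) (b≗0 n)) (ℤP.+-identityʳ (a n))

⊛-vanishˡ : ∀ a b → a ≗ zeroP → a ⊛ b ≗ zeroP
⊛-vanishˡ a b a≗0 n = trans (⊛-congʳ b a≗0 n) (⊛-zeroˡ b n)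

⊛-vanishʳ : ∀ a b → b ≗ zeroP → a ⊛ b ≗ zeroP
⊛-vanishʳ a b b≗0 n = trans (⊛-comm a b n) (⊛-vanishˡ b a b≗0 n)

monomial : ℤ → ℕ → PS
monomial c zero    zero    = c
monomial c zero    (suc n) = + 0
monomial c (suc k) zero    = + 0
monomial c (suc k) (suc n) = monomial c k n

infix 26 x^_

x^_ : ℕ → PS
x^ k = monomial (+ 1) k

monomial-≢ : ∀ c {k n} → k ≢ n → monomial c k n ≡ + 0
monomial-≢ c {zero}  {zero}  k≢n = ⊥-elim (k≢n refl)
monomial-≢ c {zero}  {suc n} k≢n = refl
monomial-≢ c {suc k} {zero}  k≢n = refl
monomial-≢ c {suc k} {suc n} k≢n = monomial-≢ c (k≢n ∘ cong suc)

monomial-< : ∀ c {k n} → n ℕ.< k → monomial c k n ≡ + 0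
monomial-< c n<k = monomial-≢ c (ℕP.>⇒≢ n<k)

monomial-≡ : ∀ c k → monomial c k k ≡ c
monomial-≡ c zero    = refl
monomial-≡ c (suc k) = monomial-≡ c k

oneP≗x^0 : oneP ≗ x^ 0
oneP≗x^0 zero    = refl
oneP≗x^0 (suc n) = refl

monomial-+ : ∀ a b k → monomial (a + b) k ≗ monomial a k +ₚ monomial b k
monomial-+ a b zero    zero    = refl
monomial-+ a b zero    (suc n) = refl
monomial-+ a b (suc k) zero    = refl
monomial-+ a b (suc k) (suc n) = monomial-+ a b k n

monomial-neg : ∀ c k → monomial (- c) k ≗ -ₚ monomial c k
monomial-neg c zero    zero    = refl
monomial-neg c zero    (suc n) = refl
monomial-neg c (suc k) zero    = refl
monomial-neg c (suc k) (suc n) = monomial-neg c k n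

monomial-*ˡ : ∀ a b k m → a * monomial b k m ≡ monomial (a * b) k m
monomial-*ˡ a b zero    zero    = refl
monomial-*ˡ a b zero    (suc m) = ℤP.*-zeroʳ a
monomial-*ˡ a b (suc k) zero    = ℤP.*-zeroʳ a
monomial-*ˡ a b (suc k) (suc m) = monomial-*ˡ a b k m

sumTo-monomial-< : ∀ c {k} (f : ℕ → ℤ) n → n ℕ.< k → sumTo (λ j → monomial c k j * f j) n ≡ + 0
sumTo-monomial-< c {suc k} f zero    _ = ℤP.*-zeroˡ (f 0)
sumTo-monomial-< c {k}     f (suc n) sn<k =
  trans (cong₂ _+_ (sumTo-monomial-< c f n (ℕP.<-trans (ℕP.n<1+n n) sn<k))
                   (trans (cong (_* f (suc n)) (monomial-< c sn<k)) (ℤP.*-zeroˡ (f (suc n)))))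
        (ℤP.+-identityʳ (+ 0))

sumTo-monomial-≤ : ∀ c {k} (f : ℕ → ℤ) n → k ℕ.≤ n → sumTo (λ j → monomial c k j * f j) n ≡ c * f k
sumTo-monomial-≤ c {zero}  f zero    _ = refl
sumTo-monomial-≤ c {zero}  f (suc n) _ = begin
  sumTo (λ j → monomial c 0 j * f j) (suc n)         ≡⟨ sumTo-unfoldˡ _ n ⟩
  c * f 0 + sumTo (λ j → + 0 * f (suc j)) n
    ≡⟨ cong (λ z → c * f 0 + z) (trans (sumTo-cong n (λ j → ℤP.*-zeroˡ (f (suc j)))) (sumTo-zero n)) ⟩
  c * f 0 + + 0                                      ≡⟨ ℤP.+-identityʳ _ ⟩
  c * f 0                                            ∎
  where open ≡-Reasoning
sumTo-monomial-≤ c {suc k} f (suc n) (s≤s k≤n) = begin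
  sumTo (λ j → monomial c (suc k) j * f j) (suc n)          ≡⟨ sumTo-unfoldˡ _ n ⟩
  + 0 * f 0 + sumTo (λ j → monomial c k j * f (suc j)) n
    ≡⟨ cong (λ z → + 0 * f 0 + z) (sumTo-monomial-≤ c (f ∘ suc) n k≤n) ⟩
  + 0 * f 0 + c * f (suc k)                                 ≡⟨ ℤP.+-identityˡ _ ⟩
  c * f (suc k)                                             ∎
  where open ≡-Reasoning

monomial-⊛-≤ : ∀ c {k n} a → k ℕ.≤ n → (monomial c k ⊛ a) n ≡ c * a (n ∸ k)
monomial-⊛-≤ c {k} {n} a = sumTo-monomial-≤ c (λ j → a (n ∸ j)) n

monomial-⊛-< : ∀ c {k n} a → n ℕ.< k → (monomial c k ⊛ a) n ≡ + 0
monomial-⊛-< c {k} {n} a = sumTo-monomial-< c (λ j → a (n ∸ j)) n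

monomial-shift : ∀ c j k m → monomial c k m ≡ monomial c (j ℕ.+ k) (j ℕ.+ m)
monomial-shift c zero    k m = refl
monomial-shift c (suc j) k m = monomial-shift c j k m

monomial-⊛-monomial : ∀ a j b k → monomial a j ⊛ monomial b k ≗ monomial (a * b) (j ℕ.+ k)
monomial-⊛-monomial a j b k n with ℕP.≤-<-connex j n
... | inj₁ j≤n = begin
  (monomial a j ⊛ monomial b k) n                   ≡⟨ monomial-⊛-≤ a (monomial b k) j≤n ⟩
  a * monomial b k (n ∸ j)                          ≡⟨ monomial-*ˡ a b k (n ∸ j) ⟩
  monomial (a * b) k (n ∸ j)                        ≡⟨ monomial-shift (a * b) j k (n ∸ j) ⟩
  monomial (a * b) (j ℕ.+ k) (j ℕ.+ (n ∸ j))        ≡⟨ cong (monomial (a * b) (j ℕ.+ k)) (ℕP.m+[n∸m]≡n j≤n) ⟩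
  monomial (a * b) (j ℕ.+ k) n                      ∎
  where open ≡-Reasoning
... | inj₂ n<j = trans (monomial-⊛-< a (monomial b k) n<j)
                       (sym (monomial-< (a * b) (ℕP.<-≤-trans n<j (ℕP.m≤m+n j k))))

monomial-cong : ∀ {a b j k} → a ≡ b → j ≡ k → monomial a j ≗ monomial b k
monomial-cong refl refl _ = refl

-- Defined so that the solver's constant 1 is oneP itself, not merely equal to it.
constant : ℤ → PS
constant (+ 1) = oneP
constant c     = monomial c 0

constant≗monomial : ∀ c → constant c ≗ monomial c 0
constant≗monomial (+ zero)        = λ _ → refl
constant≗monomial (+ suc zero)    = oneP≗x^0
constant≗monomial (+ suc (suc _)) = λ _ → refl
constant≗monomial -[1+ _ ]        = λ _ → refl

constant-homomorphism : Ring.rawRing ℤP.+-*-ring -Raw-AlmostCommutative⟶ fromCommutativeRing PS-commutativeRing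
constant-homomorphism = record
  { ⟦_⟧    = constant
  ; +-homo = λ a b n → trans (constant≗monomial (a + b) n)
               (trans (monomial-+ a b 0 n) (sym (cong₂ _+_ (constant≗monomial a n) (constant≗monomial b n))))
  ; *-homo = λ a b n → trans (constant≗monomial (a * b) n)
               (trans (sym (monomial-⊛-monomial a 0 b 0 n)) (sym (⊛-cong (constant≗monomial a) (constant≗monomial b) n)))
  ; -‿homo = λ a n → trans (constant≗monomial (- a) n)
               (trans (monomial-neg a 0 n) (cong -_ (sym (constant≗monomial a n))))
  ; 0-homo = λ { zero → refl ; (suc _) → refl }
  ; 1-homo = λ _ → refl
  }

constant-≟ : ∀ a b → Maybe (constant a ≗ constant b)
constant-≟ a b with a ℤ.≟ b
... | yes refl = just (λ _ → refl)
... | no _     = nothing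

open import Algebra.Solver.Ring (Ring.rawRing ℤP.+-*-ring) (fromCommutativeRing PS-commutativeRing)
  constant-homomorphism constant-≟
  using (solve; _:=_; _:+_; _:*_; :-_; con)

+ₚ-moveʳ : ∀ a b {c} → a +ₚ b ≗ c → a ≗ c +ₚ -ₚ b
+ₚ-moveʳ a b {c} a+b≗c n =
  trans (solve 2 (λ a b → a := (a :+ b) :+ :- b) (λ _ → refl) a b n) (+ₚ-congʳ (-ₚ b) a+b≗c n)

infix 4 _≗[_]_

record _≗[_]_ (a : PS) (M : ℕ) (b : PS) : Set where
  constructor agree
  field coeff : ∀ n → n ℕ.≤ M → a n ≡ b n
open _≗[_]_ public

≗[]-setoid : ℕ → Setoid 0ℓ 0ℓ
≗[]-setoid M = record
  { Carrier = PS
  ; _≈_ = _≗[ M ]_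
  ; isEquivalence = record
    { refl  = agree (λ _ _ → refl)
    ; sym   = λ a≗b → agree (λ n n≤M → sym (coeff a≗b n n≤M))
    ; trans = λ a≗b b≗c → agree (λ n n≤M → trans (coeff a≗b n n≤M) (coeff b≗c n n≤M)) } }

module ≗[]-Reasoning (M : ℕ) = SetoidReasoning (≗[]-setoid M)

≗⇒≗[] : ∀ {a b} M → a ≗ b → a ≗[ M ] b
≗⇒≗[] M a≗b = agree (λ n _ → a≗b n)

≗[]⇒≗ : ∀ {a b} → (∀ M → a ≗[ M ] b) → a ≗ b
≗[]⇒≗ a≗[]b n = coeff (a≗[]b n) n ℕP.≤-refl

≗[]-refl : ∀ {a M} → a ≗[ M ] a
≗[]-refl {M = M} = Setoid.refl (≗[]-setoid M)

≗[]-sym : ∀ {a b M} → a ≗[ M ] b → b ≗[ M ] a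
≗[]-sym {M = M} = Setoid.sym (≗[]-setoid M)

≗[]-trans : ∀ {a b c M} → a ≗[ M ] b → b ≗[ M ] c → a ≗[ M ] c
≗[]-trans {M = M} = Setoid.trans (≗[]-setoid M)

≗[]-mono : ∀ {a b M M′} → M′ ℕ.≤ M → a ≗[ M ] b → a ≗[ M′ ] b
≗[]-mono M′≤M a≗b = agree (λ n n≤M′ → coeff a≗b n (ℕP.≤-trans n≤M′ M′≤M))

⊛-cong-≗[] : ∀ {a a′ b b′ M} → a ≗[ M ] a′ → b ≗[ M ] b′ → a ⊛ b ≗[ M ] a′ ⊛ b′
⊛-cong-≗[] a≗a′ b≗b′ = agree (λ n n≤M → sumTo-cong-≤ n (λ k k≤n →
  cong₂ _*_ (coeff a≗a′ k (ℕP.≤-trans k≤n n≤M)) (coeff b≗b′ (n ∸ k) (ℕP.≤-trans (ℕP.m∸n≤m n k) n≤M))))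

⊛-congʳ-≗[] : ∀ {a a′ M} b → a ≗[ M ] a′ → a ⊛ b ≗[ M ] a′ ⊛ b
⊛-congʳ-≗[] {a} {a′} b a≗a′ = ⊛-cong-≗[] {a} {a′} {b} {b} a≗a′ ≗[]-refl

⊛-congˡ-≗[] : ∀ {b b′ M} a → b ≗[ M ] b′ → a ⊛ b ≗[ M ] a ⊛ b′
⊛-congˡ-≗[] {b} {b′} a b≗b′ = ⊛-cong-≗[] {a} {a} {b} {b′} ≗[]-refl b≗b′

+ₚ-cong-≗[] : ∀ {a a′ b b′ M} → a ≗[ M ] a′ → b ≗[ M ] b′ → a +ₚ b ≗[ M ] a′ +ₚ b′
+ₚ-cong-≗[] a≗a′ b≗b′ = agree (λ n n≤M → cong₂ _+_ (coeff a≗a′ n n≤M) (coeff b≗b′ n n≤M))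

+ₚ-congˡ-≗[] : ∀ {b b′ M} a → b ≗[ M ] b′ → a +ₚ b ≗[ M ] a +ₚ b′
+ₚ-congˡ-≗[] {b} {b′} a b≗b′ = +ₚ-cong-≗[] {a} {a} {b} {b′} ≗[]-refl b≗b′

monomial-≗[]-zeroP : ∀ c {k M} → M ℕ.< k → monomial c k ≗[ M ] zeroP
monomial-≗[]-zeroP c M<k = agree (λ n n≤M → monomial-< c (ℕP.≤-<-trans n≤M M<k))

monomial-⊛-≗[]-zeroP : ∀ c {k M} a → M ℕ.< k → monomial c k ⊛ a ≗[ M ] zeroP
monomial-⊛-≗[]-zeroP c a M<k = agree (λ n n≤M → monomial-⊛-< c a (ℕP.≤-<-trans n≤M M<k))

monomial-⊛-cong-≗[] : ∀ c k {a b M} → a ≗[ M ] b → monomial c k ⊛ a ≗[ k ℕ.+ M ] monomial c k ⊛ b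
monomial-⊛-cong-≗[] c k {a} {b} {M} a≗b = agree coefficients
  where
  coefficients : ∀ n → n ℕ.≤ k ℕ.+ M → (monomial c k ⊛ a) n ≡ (monomial c k ⊛ b) n
  coefficients n n≤k+M with ℕP.≤-<-connex k n
  ... | inj₁ k≤n = begin
    (monomial c k ⊛ a) n  ≡⟨ monomial-⊛-≤ c a k≤n ⟩
    c * a (n ∸ k)         ≡⟨ cong (c *_) (coeff a≗b (n ∸ k) (ℕP.m≤n+o⇒m∸n≤o n k n≤k+M)) ⟩
    c * b (n ∸ k)         ≡⟨ monomial-⊛-≤ c b k≤n ⟨
    (monomial c k ⊛ b) n  ∎
    where open ≡-Reasoning
  ... | inj₂ n<k = trans (monomial-⊛-< c a n<k) (sym (monomial-⊛-< c b n<k))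

monomial-⊛-cancel-≗[] : ∀ c k {a b M} → c * c ≡ + 1 →
  monomial c k ⊛ a ≗[ k ℕ.+ M ] monomial c k ⊛ b → a ≗[ M ] b
monomial-⊛-cancel-≗[] c k {a} {b} c²≡1 ca≗cb = agree λ n n≤M → begin
  a n                               ≡⟨ unit-cancel (a n) ⟨
  c * (c * a n)                     ≡⟨ cong (c *_) (coefficient a n) ⟨
  c * (monomial c k ⊛ a) (k ℕ.+ n)  ≡⟨ cong (c *_) (coeff ca≗cb (k ℕ.+ n) (ℕP.+-monoʳ-≤ k n≤M)) ⟩
  c * (monomial c k ⊛ b) (k ℕ.+ n)  ≡⟨ cong (c *_) (coefficient b n) ⟩
  c * (c * b n)                     ≡⟨ unit-cancel (b n) ⟩
  b n                               ∎
  where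
  open ≡-Reasoning
  coefficient : ∀ d n → (monomial c k ⊛ d) (k ℕ.+ n) ≡ c * d n
  coefficient d n = trans (monomial-⊛-≤ c d (ℕP.m≤m+n k n)) (cong (λ i → c * d i) (ℕP.m+n∸m≡n k n))
  unit-cancel : ∀ z → c * (c * z) ≡ z
  unit-cancel z = trans (sym (ℤP.*-assoc c c z)) (trans (cong (_* z) c²≡1) (ℤP.*-identityˡ z))

private
  ≡ᵇ-refl : ∀ n → (n ≡ᵇ n) ≡ true
  ≡ᵇ-refl zero    = refl
  ≡ᵇ-refl (suc n) = ≡ᵇ-refl n

  <⇒≡ᵇ-false : ∀ {k n} → k ℕ.< n → (k ≡ᵇ n) ≡ false
  <⇒≡ᵇ-false {zero}  {suc n} _         = refl
  <⇒≡ᵇ-false {suc k} {suc n} (s≤s k<n) = <⇒≡ᵇ-false k<n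

invUpTo-stable : ∀ a N {k} → k ℕ.≤ N → invUpTo a N k ≡ invPS a k
invUpTo-stable a zero    {zero} _   = refl
invUpTo-stable a (suc N) {k}    k≤N with ℕP.m≤n⇒m<n∨m≡n k≤N
... | inj₁ k<sN rewrite <⇒≡ᵇ-false k<sN = invUpTo-stable a N (ℕP.≤-pred k<sN)
... | inj₂ refl = refl

invPS-suc : ∀ a N → invPS a (suc N) ≡ - (a 0 * sumTo (λ k → a (suc k) * invPS a (N ∸ k)) N)
invPS-suc a N rewrite ≡ᵇ-refl N =
  cong (λ z → - (a 0 * z)) (sumTo-cong N (λ k → cong (a (suc k) *_) (invUpTo-stable a N (ℕP.m∸n≤m N k))))

invPS-inverseʳ : ∀ a → a 0 * a 0 ≡ + 1 → a ⊛ invPS a ≗ oneP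
invPS-inverseʳ a a₀²≡1 zero    = a₀²≡1
invPS-inverseʳ a a₀²≡1 (suc N) = begin
  sumTo (λ k → a k * invPS a (suc N ∸ k)) (suc N)  ≡⟨ sumTo-unfoldˡ _ N ⟩
  a 0 * invPS a (suc N) + S                        ≡⟨ cong (λ z → a 0 * z + S) (invPS-suc a N) ⟩
  a 0 * - (a 0 * S) + S                            ≡⟨ expand (a 0) S ⟩
  (+ 1 - a 0 * a 0) * S                            ≡⟨ cong (λ u → (+ 1 - u) * S) a₀²≡1 ⟩
  + 0 * S                                          ≡⟨ ℤP.*-zeroˡ S ⟩
  + 0                                              ∎
  where
  open ≡-Reasoning
  S = sumTo (λ k → a (suc k) * invPS a (N ∸ k)) N
  expand : ∀ u s → u * - (u * s) + s ≡ (+ 1 - u * u) * s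
  expand = ℤ-Solver.solve-∀

invPS-inverseˡ : ∀ a → a 0 * a 0 ≡ + 1 → invPS a ⊛ a ≗ oneP
invPS-inverseˡ a a₀²≡1 n = trans (⊛-comm (invPS a) a n) (invPS-inverseʳ a a₀²≡1 n)

invPS-unique : ∀ a x → a 0 * a 0 ≡ + 1 → x ⊛ a ≗ oneP → x ≗ invPS a
invPS-unique a x a₀²≡1 xa≗1 = begin
  x                   ≈⟨ ⊛-identityʳ x ⟨
  x ⊛ oneP            ≈⟨ ⊛-congˡ x (invPS-inverseʳ a a₀²≡1) ⟨
  x ⊛ (a ⊛ invPS a)   ≈⟨ ⊛-assoc x a (invPS a) ⟨
  (x ⊛ a) ⊛ invPS a   ≈⟨ ⊛-congʳ (invPS a) xa≗1 ⟩
  oneP ⊛ invPS a      ≈⟨ ⊛-identityˡ (invPS a) ⟩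
  invPS a             ∎
  where open ≗-Reasoning

invPS-cong : ∀ {a b} → a 0 * a 0 ≡ + 1 → a ≗ b → invPS a ≗ invPS b
invPS-cong {a} {b} a₀²≡1 a≗b = invPS-unique b (invPS a) b₀²≡1 (λ n →
  trans (⊛-congˡ (invPS a) (λ m → sym (a≗b m)) n) (invPS-inverseˡ a a₀²≡1 n))
  where
  b₀²≡1 : b 0 * b 0 ≡ + 1
  b₀²≡1 = trans (sym (cong₂ _*_ (a≗b 0) (a≗b 0))) a₀²≡1

invPS-⊛ : ∀ a b → a 0 * a 0 ≡ + 1 → b 0 * b 0 ≡ + 1 → invPS (a ⊛ b) ≗ invPS a ⊛ invPS b
invPS-⊛ a b a₀²≡1 b₀²≡1 n = sym (invPS-unique (a ⊛ b) (invPS a ⊛ invPS b) ab₀²≡1 inverse n)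
  where
  module ℤ* = CommutativeSemigroupProperties ℤP.*-commutativeSemigroup
  ab₀²≡1 : (a ⊛ b) 0 * (a ⊛ b) 0 ≡ + 1
  ab₀²≡1 = trans (ℤ*.interchange (a 0) (b 0) (a 0) (b 0)) (cong₂ _*_ a₀²≡1 b₀²≡1)
  inverse : (invPS a ⊛ invPS b) ⊛ (a ⊛ b) ≗ oneP
  inverse = begin
    (invPS a ⊛ invPS b) ⊛ (a ⊛ b)  ≈⟨ ⊛.interchange (invPS a) (invPS b) a b ⟩
    (invPS a ⊛ a) ⊛ (invPS b ⊛ b)  ≈⟨ ⊛-cong (invPS-inverseˡ a a₀²≡1) (invPS-inverseˡ b b₀²≡1) ⟩
    oneP ⊛ oneP                    ≈⟨ ⊛-identityˡ oneP ⟩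
    oneP                           ∎
    where open ≗-Reasoning

⊛-invPS-cancelʳ : ∀ a x → a 0 * a 0 ≡ + 1 → (x ⊛ a) ⊛ invPS a ≗ x
⊛-invPS-cancelʳ a x a₀²≡1 = begin
  (x ⊛ a) ⊛ invPS a  ≈⟨ ⊛-assoc x a (invPS a) ⟩
  x ⊛ (a ⊛ invPS a)  ≈⟨ ⊛-congˡ x (invPS-inverseʳ a a₀²≡1) ⟩
  x ⊛ oneP           ≈⟨ ⊛-identityʳ x ⟩
  x                  ∎
  where open ≗-Reasoning

⊛-cancelʳ : ∀ a {x y} → a 0 * a 0 ≡ + 1 → x ⊛ a ≗ y ⊛ a → x ≗ y
⊛-cancelʳ a {x} {y} a₀²≡1 xa≗ya = begin
  x                   ≈⟨ ⊛-invPS-cancelʳ a x a₀²≡1 ⟨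
  (x ⊛ a) ⊛ invPS a   ≈⟨ ⊛-congʳ (invPS a) xa≗ya ⟩
  (y ⊛ a) ⊛ invPS a   ≈⟨ ⊛-invPS-cancelʳ a y a₀²≡1 ⟩
  y                   ∎
  where open ≗-Reasoning

module _ {A : Set} (_∙_ : A → A → A) (ε : A) where

  big : (ℕ → A) → ℕ → A
  big f zero    = ε
  big f (suc n) = big f n ∙ f n

module BigProperties (M : CommutativeMonoid 0ℓ 0ℓ) where
  private module M = CommutativeMonoid M
  open M using (Carrier; _∙_; ε; ∙-cong; ∙-congˡ; ∙-congʳ; assoc; comm; identityˡ; identityʳ)
    renaming (_≈_ to _≈ᴹ_)
  open SetoidReasoning M.setoid
  private
    module ∙ = CommutativeSemigroupProperties M.commutativeSemigroup
    Σ : (ℕ → Carrier) → ℕ → Carrier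
    Σ = big _∙_ ε

  cong-< : ∀ {f g} n → (∀ i → i ℕ.< n → f i ≈ᴹ g i) → Σ f n ≈ᴹ Σ g n
  cong-< zero    f≈g = M.refl
  cong-< (suc n) f≈g = ∙-cong (cong-< n (λ i i<n → f≈g i (ℕP.m<n⇒m<1+n i<n))) (f≈g n ℕP.≤-refl)

  identity : ∀ {f} n → (∀ i → i ℕ.< n → f i ≈ᴹ ε) → Σ f n ≈ᴹ ε
  identity zero    f≈ε = M.refl
  identity (suc n) f≈ε =
    M.trans (∙-cong (identity n (λ i i<n → f≈ε i (ℕP.m<n⇒m<1+n i<n))) (f≈ε n ℕP.≤-refl)) (identityˡ ε)

  homo : ∀ f g n → Σ (λ i → f i ∙ g i) n ≈ᴹ Σ f n ∙ Σ g n
  homo f g zero    = M.sym (identityˡ ε)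
  homo f g (suc n) = M.trans (∙-congʳ (homo f g n)) (∙.interchange (Σ f n) (Σ g n) (f n) (g n))

  split : ∀ f m n → Σ f (m ℕ.+ n) ≈ᴹ Σ f m ∙ Σ (λ i → f (m ℕ.+ i)) n
  split f m zero    rewrite ℕP.+-identityʳ m = M.sym (identityʳ (Σ f m))
  split f m (suc n) rewrite ℕP.+-suc m n =
    M.trans (∙-congʳ (split f m n)) (assoc (Σ f m) (Σ (λ i → f (m ℕ.+ i)) n) (f (m ℕ.+ n)))

  unfoldˡ : ∀ f n → Σ f (suc n) ≈ᴹ f 0 ∙ Σ (f ∘ suc) n
  unfoldˡ f n = M.trans (split f 1 n) (∙-congʳ (identityˡ (f 0)))

  reverse : ∀ f n → Σ (λ i → f (n ∸ suc i)) n ≈ᴹ Σ f n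
  reverse f zero    = M.refl
  reverse f (suc n) = begin
    Σ (λ i → f (n ∸ i)) (suc n)      ≈⟨ unfoldˡ _ n ⟩
    f n ∙ Σ (λ i → f (n ∸ suc i)) n  ≈⟨ ∙-congˡ (reverse f n) ⟩
    f n ∙ Σ f n                      ≈⟨ comm (f n) (Σ f n) ⟩
    Σ f (suc n)                      ∎

  centred : ∀ f n → Σ f (suc (n ℕ.+ n)) ≈ᴹ f n ∙ Σ (λ t → f (suc n ℕ.+ t) ∙ f (n ∸ suc t)) n
  centred f n = begin
    Σ f (suc n ℕ.+ n)                                           ≈⟨ split f (suc n) n ⟩
    (Σ f n ∙ f n) ∙ Σ (λ t → f (suc n ℕ.+ t)) n                 ≈⟨ ∙-congʳ (comm (Σ f n) (f n)) ⟩
    (f n ∙ Σ f n) ∙ Σ (λ t → f (suc n ℕ.+ t)) n                 ≈⟨ assoc (f n) (Σ f n) _ ⟩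
    f n ∙ (Σ f n ∙ Σ (λ t → f (suc n ℕ.+ t)) n)                 ≈⟨ ∙-congˡ (comm (Σ f n) _) ⟩
    f n ∙ (Σ (λ t → f (suc n ℕ.+ t)) n ∙ Σ f n)                 ≈⟨ ∙-congˡ (∙-congˡ (reverse f n)) ⟨
    f n ∙ (Σ (λ t → f (suc n ℕ.+ t)) n ∙ Σ (λ t → f (n ∸ suc t)) n)
                                                                ≈⟨ ∙-congˡ (homo _ _ n) ⟨
    f n ∙ Σ (λ t → f (suc n ℕ.+ t) ∙ f (n ∸ suc t)) n           ∎

truncatedCommutativeMonoid : ℕ → (_∙_ : PS → PS → PS) (ε : PS) → IsCommutativeMonoid _≗_ _∙_ ε →
  (∀ {M a a′ b b′} → a ≗[ M ] a′ → b ≗[ M ] b′ → (a ∙ b) ≗[ M ] (a′ ∙ b′)) → CommutativeMonoid 0ℓ 0ℓ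
truncatedCommutativeMonoid M _∙_ ε isCM ∙-cong-≗[] = record
  { Carrier = PS ; _≈_ = _≗[ M ]_ ; _∙_ = _∙_ ; ε = ε
  ; isCommutativeMonoid = record
    { isMonoid = record
      { isSemigroup = record
        { isMagma = record { isEquivalence = Setoid.isEquivalence (≗[]-setoid M) ; ∙-cong = ∙-cong-≗[] }
        ; assoc = λ a b c → ≗⇒≗[] M (assoc a b c) }
      ; identity = (λ a → ≗⇒≗[] M (identityˡ a)) , (λ a → ≗⇒≗[] M (identityʳ a)) }
    ; comm = λ a b → ≗⇒≗[] M (comm a b) } }
  where open IsCommutativeMonoid isCM

∏ : (ℕ → PS) → ℕ → PS
∏ = big _⊛_ oneP

∑ : (ℕ → PS) → ℕ → PS
∑ = big _+ₚ_ zeroP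

infixr 25 _^_

_^_ : PS → ℕ → PS
a ^ n = ∏ (λ _ → a) n

module ∏ = BigProperties (CommutativeRing.*-commutativeMonoid PS-commutativeRing)
module ∑ = BigProperties (CommutativeRing.+-commutativeMonoid PS-commutativeRing)
module ∏-≗[] M = BigProperties (truncatedCommutativeMonoid M _⊛_ oneP
  (CommutativeRing.*-isCommutativeMonoid PS-commutativeRing) ⊛-cong-≗[])
module ∑-≗[] M = BigProperties (truncatedCommutativeMonoid M _+ₚ_ zeroP
  (CommutativeRing.+-isCommutativeMonoid PS-commutativeRing) +ₚ-cong-≗[])

∏-cong : ∀ {f g} n → (∀ i → f i ≗ g i) → ∏ f n ≗ ∏ g n
∏-cong n f≗g = ∏.cong-< n (λ i _ → f≗g i)

∑-cong : ∀ {f g} n → (∀ i → f i ≗ g i) → ∑ f n ≗ ∑ g n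
∑-cong n f≗g = ∑.cong-< n (λ i _ → f≗g i)

⊛-∑ : ∀ c f n → c ⊛ ∑ f n ≗ ∑ (λ i → c ⊛ f i) n
⊛-∑ c f zero    = λ n → trans (⊛-comm c zeroP n) (⊛-zeroˡ c n)
⊛-∑ c f (suc n) m = trans (⊛-distribˡ c (∑ f n) (f n) m) (cong (_+ (c ⊛ f n) m) (⊛-∑ c f n m))

^-+ : ∀ a m n → a ^ (m ℕ.+ n) ≗ a ^ m ⊛ a ^ n
^-+ a = ∏.split (λ _ → a)

^-⊛ : ∀ a b n → (a ⊛ b) ^ n ≗ a ^ n ⊛ b ^ n
^-⊛ a b = ∏.homo (λ _ → a) (λ _ → b)

^-cong-≗[] : ∀ {a b M} n → a ≗[ M ] b → a ^ n ≗[ M ] b ^ n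
^-cong-≗[] {M = M} n a≗b = ∏-≗[].cong-< M n (λ _ _ → a≗b)

monomial-^ : ∀ c k n → monomial c k ^ n ≗ monomial (c ℤ.^ n) (n ℕ.* k)
monomial-^ c k zero    = oneP≗x^0
monomial-^ c k (suc n) = begin
  monomial c k ^ n ⊛ monomial c k                  ≈⟨ ⊛-congʳ (monomial c k) (monomial-^ c k n) ⟩
  monomial (c ℤ.^ n) (n ℕ.* k) ⊛ monomial c k      ≈⟨ monomial-⊛-monomial (c ℤ.^ n) (n ℕ.* k) c k ⟩
  monomial (c ℤ.^ n * c) (n ℕ.* k ℕ.+ k)           ≈⟨ monomial-cong (ℤP.*-comm (c ℤ.^ n) c) (ℕP.+-comm (n ℕ.* k) k) ⟩
  monomial (c ℤ.^ suc n) (suc n ℕ.* k)             ∎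
  where open ≗-Reasoning

x^-^ : ∀ k n → (x^ k) ^ n ≗ x^ (n ℕ.* k)
x^-^ k n m = trans (monomial-^ (+ 1) k n m) (monomial-cong {j = n ℕ.* k} (ℤP.^-zeroˡ n) refl m)

-- The q-binomial theorem

triangular : ℕ → ℕ
triangular zero    = 0
triangular (suc j) = triangular j ℕ.+ j

module _ (q : PS) where

  gaussian : ℕ → ℕ → PS
  gaussian m       zero    = oneP
  gaussian zero    (suc j) = zeroP
  gaussian (suc m) (suc j) = gaussian m j +ₚ q ^ suc j ⊛ gaussian m (suc j)

  gaussian-> : ∀ {m j} → m ℕ.< j → gaussian m j ≗ zeroP
  gaussian-> {zero}  {suc j} _         = λ _ → refl
  gaussian-> {suc m} {suc j} (s≤s m<j) n = begin
    gaussian m j n + (q ^ suc j ⊛ gaussian m (suc j)) n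
      ≡⟨ cong₂ _+_ (gaussian-> m<j n) (⊛-vanishʳ (q ^ suc j) _ (gaussian-> (ℕP.m<n⇒m<1+n m<j)) n) ⟩
    + 0 + + 0 ∎
    where open ≡-Reasoning

  binomialTerm : PS → PS → ℕ → ℕ → PS
  binomialTerm u v m j = gaussian m j ⊛ (q ^ triangular j ⊛ (v ^ j ⊛ u ^ (m ∸ j)))

  private
    binomialTerm-> : ∀ u v m → binomialTerm u v m (suc m) ≗ zeroP
    binomialTerm-> u v m =
      ⊛-vanishˡ (gaussian m (suc m)) (q ^ triangular (suc m) ⊛ (v ^ suc m ⊛ u ^ (m ∸ suc m))) (gaussian-> {m} ℕP.≤-refl)

    binomialTerm-zero : ∀ u v m → binomialTerm u v (suc m) 0 ≗ u ⊛ binomialTerm u (v ⊛ q) m 0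
    binomialTerm-zero u v m =
      solve 2 (λ u U → one :* (one :* (one :* (U :* u))) := u :* (one :* (one :* (one :* U))))
            (λ _ → refl) u (u ^ m)
      where one = con (+ 1)

    pascal-left : ∀ u v m j → gaussian m j ⊛ (q ^ triangular (suc j) ⊛ (v ^ suc j ⊛ u ^ (suc m ∸ suc j)))
                                ≗ v ⊛ binomialTerm u (v ⊛ q) m j
    pascal-left u v m j = begin
      g ⊛ (q ^ (triangular j ℕ.+ j) ⊛ ((v ^ j ⊛ v) ⊛ U))
        ≈⟨ ⊛-congˡ g (⊛-congʳ ((v ^ j ⊛ v) ⊛ U) (^-+ q (triangular j) j)) ⟩
      g ⊛ ((q ^ triangular j ⊛ q ^ j) ⊛ ((v ^ j ⊛ v) ⊛ U))
        ≈⟨ solve 6 (λ g Q P V v U → g :* ((Q :* P) :* ((V :* v) :* U)) := v :* (g :* (Q :* ((V :* P) :* U))))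
                 (λ _ → refl) g (q ^ triangular j) (q ^ j) (v ^ j) v U ⟩
      v ⊛ (g ⊛ (q ^ triangular j ⊛ ((v ^ j ⊛ q ^ j) ⊛ U)))
        ≈⟨ ⊛-congˡ v (⊛-congˡ g (⊛-congˡ (q ^ triangular j) (⊛-congʳ U (^-⊛ v q j)))) ⟨
      v ⊛ binomialTerm u (v ⊛ q) m j ∎
      where open ≗-Reasoning
            g = gaussian m j
            U = u ^ (m ∸ j)

    pascal-right : ∀ u v m j → j ℕ.≤ m →
      (q ^ suc j ⊛ gaussian m (suc j)) ⊛ (q ^ triangular (suc j) ⊛ (v ^ suc j ⊛ u ^ (suc m ∸ suc j)))
        ≗ u ⊛ binomialTerm u (v ⊛ q) m (suc j)
    pascal-right u v m j j≤m with ℕP.m≤n⇒m<n∨m≡n j≤m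
    ... | inj₂ refl = λ n → trans
      (⊛-vanishˡ (q ^ suc j ⊛ gaussian j (suc j)) (q ^ triangular (suc j) ⊛ (v ^ suc j ⊛ u ^ (j ∸ j)))
                 (⊛-vanishʳ (q ^ suc j) (gaussian j (suc j)) (gaussian-> {j} ℕP.≤-refl)) n)
      (sym (⊛-vanishʳ u (binomialTerm u (v ⊛ q) j (suc j)) (binomialTerm-> u (v ⊛ q) j) n))
    ... | inj₁ j<m = begin
      (Q₁ ⊛ g) ⊛ (Qₜ ⊛ (v ^ suc j ⊛ u ^ (m ∸ j)))
        ≈⟨ ⊛-congˡ (Q₁ ⊛ g) (⊛-congˡ Qₜ (⊛-congˡ (v ^ suc j) u^[m∸j]≗u^[m∸j∸1]⊛u)) ⟩
      (Q₁ ⊛ g) ⊛ (Qₜ ⊛ (v ^ suc j ⊛ (U ⊛ u)))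
        ≈⟨ solve 6 (λ Q₁ g T V U u → (Q₁ :* g) :* (T :* (V :* (U :* u))) := u :* (g :* (T :* ((V :* Q₁) :* U))))
                 (λ _ → refl) Q₁ g Qₜ (v ^ suc j) U u ⟩
      u ⊛ (g ⊛ (Qₜ ⊛ ((v ^ suc j ⊛ Q₁) ⊛ U)))
        ≈⟨ ⊛-congˡ u (⊛-congˡ g (⊛-congˡ Qₜ (⊛-congʳ U (^-⊛ v q (suc j))))) ⟨
      u ⊛ binomialTerm u (v ⊛ q) m (suc j) ∎
      where open ≗-Reasoning
            Q₁ = q ^ suc j
            g = gaussian m (suc j)
            Qₜ = q ^ triangular (suc j)
            U = u ^ (m ∸ suc j)
            u^[m∸j]≗u^[m∸j∸1]⊛u : u ^ (m ∸ j) ≗ U ⊛ u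
            u^[m∸j]≗u^[m∸j∸1]⊛u n = cong (λ e → (u ^ e) n) (ℕP.+-∸-assoc 1 j<m)

    binomialTerm-pascal : ∀ u v m j → j ℕ.≤ m →
      binomialTerm u v (suc m) (suc j) ≗ v ⊛ binomialTerm u (v ⊛ q) m j +ₚ u ⊛ binomialTerm u (v ⊛ q) m (suc j)
    binomialTerm-pascal u v m j j≤m = begin
      (gaussian m j +ₚ q ^ suc j ⊛ gaussian m (suc j)) ⊛ W
        ≈⟨ ⊛-distribʳ W (gaussian m j) (q ^ suc j ⊛ gaussian m (suc j)) ⟩
      gaussian m j ⊛ W +ₚ (q ^ suc j ⊛ gaussian m (suc j)) ⊛ W
        ≈⟨ +ₚ-cong (pascal-left u v m j) (pascal-right u v m j j≤m) ⟩
      v ⊛ binomialTerm u (v ⊛ q) m j +ₚ u ⊛ binomialTerm u (v ⊛ q) m (suc j) ∎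
      where open ≗-Reasoning
            W = q ^ triangular (suc j) ⊛ (v ^ suc j ⊛ u ^ (suc m ∸ suc j))

    binomial-step : ∀ u v m →
      (u +ₚ v) ⊛ ∑ (binomialTerm u (v ⊛ q) m) (suc m) ≗ ∑ (binomialTerm u v (suc m)) (suc (suc m))
    binomial-step u v m = begin
      (u +ₚ v) ⊛ ∑ t (suc m)
        ≈⟨ ⊛-distribʳ (∑ t (suc m)) u v ⟩
      u ⊛ ∑ t (suc m) +ₚ v ⊛ ∑ t (suc m)
        ≈⟨ +ₚ-congˡ (u ⊛ ∑ t (suc m)) (⊛-∑ v t (suc m)) ⟩
      u ⊛ ∑ t (suc m) +ₚ V
        ≈⟨ +ₚ-congʳ V (⊛-congˡ u (+ₚ-identityʳ-≗ (∑ t (suc m)) (binomialTerm-> u (v ⊛ q) m))) ⟨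
      u ⊛ ∑ t (suc (suc m)) +ₚ V
        ≈⟨ +ₚ-congʳ V (⊛-congˡ u (∑.unfoldˡ t (suc m))) ⟩
      u ⊛ (t 0 +ₚ ∑ (t ∘ suc) (suc m)) +ₚ V
        ≈⟨ +ₚ-congʳ V (⊛-distribˡ u (t 0) (∑ (t ∘ suc) (suc m))) ⟩
      u ⊛ t 0 +ₚ u ⊛ ∑ (t ∘ suc) (suc m) +ₚ V
        ≈⟨ +ₚ-congʳ V (+ₚ-congˡ (u ⊛ t 0) (⊛-∑ u (t ∘ suc) (suc m))) ⟩
      u ⊛ t 0 +ₚ U +ₚ V
        ≈⟨ +ₚ-assoc (u ⊛ t 0) U V ⟩
      u ⊛ t 0 +ₚ (U +ₚ V)
        ≈⟨ +ₚ-congˡ (u ⊛ t 0) (+ₚ-comm U V) ⟩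
      u ⊛ t 0 +ₚ (V +ₚ U)
        ≈⟨ +ₚ-cong (binomialTerm-zero u v m) (∑.homo (λ j → v ⊛ t j) (λ j → u ⊛ t (suc j)) (suc m)) ⟨
      binomialTerm u v (suc m) 0 +ₚ ∑ (λ j → v ⊛ t j +ₚ u ⊛ t (suc j)) (suc m)
        ≈⟨ +ₚ-congˡ (binomialTerm u v (suc m) 0)
                    (∑.cong-< (suc m) (λ j j<sm → binomialTerm-pascal u v m j (ℕP.≤-pred j<sm))) ⟨
      binomialTerm u v (suc m) 0 +ₚ ∑ (binomialTerm u v (suc m) ∘ suc) (suc m)
        ≈⟨ ∑.unfoldˡ (binomialTerm u v (suc m)) (suc m) ⟨
      ∑ (binomialTerm u v (suc m)) (suc (suc m)) ∎
      where
      open ≗-Reasoning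
      t = binomialTerm u (v ⊛ q) m
      U = ∑ (λ j → u ⊛ t (suc j)) (suc m)
      V = ∑ (λ j → v ⊛ t j) (suc m)

  q-binomial : ∀ u v m → ∏ (λ i → u +ₚ v ⊛ q ^ i) m ≗ ∑ (binomialTerm u v m) (suc m)
  q-binomial u v zero = begin
    oneP                                       ≈⟨ ⊛-identityˡ oneP ⟨
    oneP ⊛ oneP                                ≈⟨ ⊛-congˡ oneP (⊛-identityˡ oneP) ⟨
    oneP ⊛ (oneP ⊛ oneP)                       ≈⟨ ⊛-congˡ oneP (⊛-identityˡ (oneP ⊛ oneP)) ⟨
    oneP ⊛ (oneP ⊛ (oneP ⊛ oneP))              ≈⟨ +ₚ-identityˡ (oneP ⊛ (oneP ⊛ (oneP ⊛ oneP))) ⟨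
    zeroP +ₚ oneP ⊛ (oneP ⊛ (oneP ⊛ oneP))     ∎
    where open ≗-Reasoning
  q-binomial u v (suc m) = begin
    ∏ (λ i → u +ₚ v ⊛ q ^ i) (suc m)
      ≈⟨ ∏.unfoldˡ _ m ⟩
    (u +ₚ v ⊛ oneP) ⊛ ∏ (λ i → u +ₚ v ⊛ (q ^ i ⊛ q)) m
      ≈⟨ ⊛-cong (+ₚ-congˡ u (⊛-identityʳ v)) (∏-cong m (λ i → +ₚ-congˡ u (⊛.x∙yz≈xz∙y v (q ^ i) q))) ⟩
    (u +ₚ v) ⊛ ∏ (λ i → u +ₚ (v ⊛ q) ⊛ q ^ i) m
      ≈⟨ ⊛-congˡ (u +ₚ v) (q-binomial u (v ⊛ q) m) ⟩
    (u +ₚ v) ⊛ ∑ (binomialTerm u (v ⊛ q) m) (suc m)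
      ≈⟨ binomial-step u v m ⟩
    ∑ (binomialTerm u v (suc m)) (suc (suc m)) ∎
    where open ≗-Reasoning

  qPochhammer : ℕ → PS
  qPochhammer k = ∏ (λ i → oneP +ₚ -ₚ q ^ suc i) k

  gaussian-qPochhammer : ∀ m j → j ℕ.≤ m → (gaussian m j ⊛ qPochhammer j) ⊛ qPochhammer (m ∸ j) ≗ qPochhammer m
  gaussian-qPochhammer zero    zero    _         = begin
    (oneP ⊛ oneP) ⊛ oneP  ≈⟨ ⊛-identityʳ (oneP ⊛ oneP) ⟩
    oneP ⊛ oneP           ≈⟨ ⊛-identityʳ oneP ⟩
    oneP                  ∎
    where open ≗-Reasoning
  gaussian-qPochhammer (suc m) zero    _         = begin
    (oneP ⊛ oneP) ⊛ qPochhammer (suc m)  ≈⟨ ⊛-congʳ (qPochhammer (suc m)) (⊛-identityʳ oneP) ⟩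
    oneP ⊛ qPochhammer (suc m)           ≈⟨ ⊛-identityˡ (qPochhammer (suc m)) ⟩
    qPochhammer (suc m)                  ∎
    where open ≗-Reasoning
  gaussian-qPochhammer (suc m) (suc j) (s≤s j≤m) = begin
    ((gaussian m j +ₚ Q ⊛ gaussian m (suc j)) ⊛ (qPochhammer j ⊛ f (suc j))) ⊛ qPochhammer (m ∸ j)
      ≈⟨ solve 6 (λ g Q h P f R → ((g :+ Q :* h) :* (P :* f)) :* R := ((g :* P) :* R) :* f :+ Q :* ((h :* (P :* f)) :* R))
               (λ _ → refl) (gaussian m j) Q (gaussian m (suc j)) (qPochhammer j) (f (suc j)) (qPochhammer (m ∸ j)) ⟩
    ((gaussian m j ⊛ qPochhammer j) ⊛ qPochhammer (m ∸ j)) ⊛ f (suc j) +ₚ Q ⊛ rest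
      ≈⟨ +ₚ-congʳ (Q ⊛ rest) (⊛-congʳ (f (suc j)) (gaussian-qPochhammer m j j≤m)) ⟩
    qPochhammer m ⊛ f (suc j) +ₚ Q ⊛ rest
      ≈⟨ last-factor (ℕP.m≤n⇒m<n∨m≡n j≤m) ⟩
    qPochhammer m ⊛ f (suc m)  ∎
    where
    open ≗-Reasoning
    f : ℕ → PS
    f i = oneP +ₚ -ₚ q ^ i
    Q = q ^ suc j
    rest = (gaussian m (suc j) ⊛ qPochhammer (suc j)) ⊛ qPochhammer (m ∸ j)
    last-factor : j ℕ.< m ⊎ j ≡ m → qPochhammer m ⊛ f (suc j) +ₚ Q ⊛ rest ≗ qPochhammer m ⊛ f (suc m)
    last-factor (inj₁ j<m) = begin
      qPochhammer m ⊛ f (suc j) +ₚ Q ⊛ rest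
        ≈⟨ +ₚ-congˡ (qPochhammer m ⊛ f (suc j)) (⊛-congˡ Q (begin
             rest
               ≈⟨ ⊛-congˡ (gaussian m (suc j) ⊛ qPochhammer (suc j)) (λ n → cong (λ e → qPochhammer e n) (ℕP.+-∸-assoc 1 j<m)) ⟩
             (gaussian m (suc j) ⊛ qPochhammer (suc j)) ⊛ (qPochhammer k ⊛ f (suc k))
               ≈⟨ ⊛-assoc (gaussian m (suc j) ⊛ qPochhammer (suc j)) (qPochhammer k) (f (suc k)) ⟨
             ((gaussian m (suc j) ⊛ qPochhammer (suc j)) ⊛ qPochhammer k) ⊛ f (suc k)
               ≈⟨ ⊛-congʳ (f (suc k)) (gaussian-qPochhammer m (suc j) j<m) ⟩
             qPochhammer m ⊛ f (suc k) ∎)) ⟩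
      qPochhammer m ⊛ f (suc j) +ₚ Q ⊛ (qPochhammer m ⊛ f (suc k))
        ≈⟨ solve 3 (λ P Q R → P :* (one :+ :- Q) :+ Q :* (P :* (one :+ :- R)) := P :* (one :+ :- (Q :* R)))
                 (λ _ → refl) (qPochhammer m) Q (q ^ suc k) ⟩
      qPochhammer m ⊛ (oneP +ₚ -ₚ (Q ⊛ q ^ suc k))
        ≈⟨ ⊛-congˡ (qPochhammer m) (+ₚ-congˡ oneP (λ n → cong -_ (^-+ q (suc j) (suc k) n))) ⟨
      qPochhammer m ⊛ f (suc j ℕ.+ suc k)
        ≈⟨ (λ n → cong (λ e → (qPochhammer m ⊛ f e) n) exponent) ⟩
      qPochhammer m ⊛ f (suc m) ∎
      where
      one = con (+ 1)
      k = m ∸ suc j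
      exponent : suc j ℕ.+ suc k ≡ suc m
      exponent = trans (ℕP.+-suc (suc j) k) (cong suc (ℕP.m+[n∸m]≡n j<m))
    last-factor (inj₂ refl) = +ₚ-identityʳ-≗ (qPochhammer m ⊛ f (suc m))
      (⊛-vanishʳ Q rest (⊛-vanishˡ _ (qPochhammer (m ∸ m))
         (⊛-vanishˡ (gaussian m (suc m)) (qPochhammer (suc m)) (gaussian-> {m} ℕP.≤-refl))))

factor≗ : ∀ c → factor c ≗ oneP +ₚ -ₚ x^ c
factor≗ c n = cong₂ _-_ (constant-term n) (x^-coefficient n c)
  where
  constant-term : ∀ n → (if n ≡ᵇ 0 then + 1 else + 0) ≡ oneP n
  constant-term zero    = refl
  constant-term (suc n) = refl
  x^-coefficient : ∀ n c → (if n ≡ᵇ c then + 1 else + 0) ≡ (x^ c) n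
  x^-coefficient zero    zero    = refl
  x^-coefficient zero    (suc c) = refl
  x^-coefficient (suc n) zero    = refl
  x^-coefficient (suc n) (suc c) = x^-coefficient n c

factor-≗[]-oneP : ∀ {c M} → M ℕ.< c → factor c ≗[ M ] oneP
factor-≗[]-oneP {c} M<c = agree λ n n≤M →
  trans (factor≗ c n) (trans (cong (λ z → oneP n + - z) (monomial-< (+ 1) (ℕP.≤-<-trans n≤M M<c))) (ℤP.+-identityʳ _))

finProd-stable : ∀ S e → (∀ k → k ℕ.≤ e k) → ∀ {M} K → M ℕ.≤ K → finProd S e K ≗[ M ] finProd S e M
finProd-stable S e k≤e {M} zero    z≤n  = ≗[]-refl
finProd-stable S e k≤e {M} (suc K) M≤sK with ℕP.m≤n⇒m<n∨m≡n M≤sK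
... | inj₂ refl = ≗[]-refl
... | inj₁ M<sK with S (suc K)
...   | false = finProd-stable S e k≤e K (ℕP.≤-pred M<sK)
...   | true  = begin
  finProd S e K ⊛ factor (e (suc K))
    ≈⟨ ⊛-congˡ-≗[] (finProd S e K) (factor-≗[]-oneP (ℕP.<-≤-trans M<sK (k≤e (suc K)))) ⟩
  finProd S e K ⊛ oneP                ≈⟨ ≗⇒≗[] M (⊛-identityʳ (finProd S e K)) ⟩
  finProd S e K                       ≈⟨ finProd-stable S e k≤e K (ℕP.≤-pred M<sK) ⟩
  finProd S e M                       ∎
  where open ≗[]-Reasoning M

infProd-≗[]-finProd : ∀ S e → (∀ k → k ℕ.≤ e k) → ∀ {M} K → M ℕ.≤ K → infProd S e ≗[ M ] finProd S e K
infProd-≗[]-finProd S e k≤e K M≤K = agree λ n n≤M →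
  sym (coeff (finProd-stable S e k≤e K (ℕP.≤-trans n≤M M≤K)) n ℕP.≤-refl)

k≤c*k : ∀ c .{{_ : NonZero c}} k → k ℕ.≤ c ℕ.* k
k≤c*k c k = ℕP.m≤n*m k c

d≤[1+2d]*c : ∀ c .{{_ : NonZero c}} d → d ℕ.≤ suc (d ℕ.+ d) ℕ.* c
d≤[1+2d]*c c d = ℕP.≤-trans (ℕP.≤-trans (ℕP.m≤m+n d d) (ℕP.n≤1+n _)) (ℕP.m≤m*n (suc (d ℕ.+ d)) c)

factorPower : (ℕ → ℕ) → ℕ → PS
factorPower μ K = ∏ (λ i → factor (suc i) ^ μ (suc i)) K

multiplicityProduct : (ℕ → ℕ) → PS
multiplicityProduct μ n = factorPower μ n n

oneP-^ : ∀ n → oneP ^ n ≗ oneP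
oneP-^ n = ∏.identity n (λ _ _ _ → refl)

factorPower-stable : ∀ μ {M} K → M ℕ.≤ K → factorPower μ K ≗[ M ] factorPower μ M
factorPower-stable μ {M} K M≤K = begin
  factorPower μ K                                   ≡⟨ cong (factorPower μ) (sym (ℕP.m+[n∸m]≡n M≤K)) ⟩
  factorPower μ (M ℕ.+ (K ∸ M))                     ≈⟨ ≗⇒≗[] M (∏.split g M (K ∸ M)) ⟩
  factorPower μ M ⊛ ∏ (λ i → g (M ℕ.+ i)) (K ∸ M)
    ≈⟨ ⊛-congˡ-≗[] (factorPower μ M) (∏-≗[].identity M (K ∸ M) (λ i _ → high-factor i)) ⟩
  factorPower μ M ⊛ oneP                            ≈⟨ ≗⇒≗[] M (⊛-identityʳ (factorPower μ M)) ⟩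
  factorPower μ M                                   ∎
  where
  open ≗[]-Reasoning M
  g : ℕ → PS
  g i = factor (suc i) ^ μ (suc i)
  high-factor : ∀ i → g (M ℕ.+ i) ≗[ M ] oneP
  high-factor i = ≗[]-trans (^-cong-≗[] (μ (suc (M ℕ.+ i))) (factor-≗[]-oneP (s≤s (ℕP.m≤m+n M i))))
                            (≗⇒≗[] M (oneP-^ (μ (suc (M ℕ.+ i)))))

multiplicityProduct-≗[] : ∀ μ {M} K → M ℕ.≤ K → multiplicityProduct μ ≗[ M ] factorPower μ K
multiplicityProduct-≗[] μ K M≤K = agree λ n n≤M →
  sym (coeff (factorPower-stable μ K (ℕP.≤-trans n≤M M≤K)) n ℕP.≤-refl)

multiplicityProduct-+ : ∀ μ ν → multiplicityProduct (λ d → μ d ℕ.+ ν d) ≗ multiplicityProduct μ ⊛ multiplicityProduct ν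
multiplicityProduct-+ μ ν n = begin
  factorPower (λ d → μ d ℕ.+ ν d) n n
    ≡⟨ ∏-cong n (λ i → ^-+ (factor (suc i)) (μ (suc i)) (ν (suc i))) n ⟩
  ∏ (λ i → factor (suc i) ^ μ (suc i) ⊛ factor (suc i) ^ ν (suc i)) n n
    ≡⟨ ∏.homo (λ i → factor (suc i) ^ μ (suc i)) (λ i → factor (suc i) ^ ν (suc i)) n n ⟩
  (factorPower μ n ⊛ factorPower ν n) n
    ≡⟨ coeff (⊛-cong-≗[] (≗[]-sym (multiplicityProduct-≗[] μ n ℕP.≤-refl))
                         (≗[]-sym (multiplicityProduct-≗[] ν n ℕP.≤-refl))) n ℕP.≤-refl ⟩
  (multiplicityProduct μ ⊛ multiplicityProduct ν) n ∎
  where open ≡-Reasoning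

multiplicityProduct-cong : ∀ {μ ν} → (∀ d → μ (suc d) ≡ ν (suc d)) → multiplicityProduct μ ≗ multiplicityProduct ν
multiplicityProduct-cong μ≡ν n = ∏-cong n (λ i m → cong (λ k → (factor (suc i) ^ k) m) (μ≡ν i)) n

multiplicity : (ℕ → Bool) → (c : ℕ) .{{_ : NonZero c}} → ℕ → ℕ
multiplicity S c d = if (d ℕ.% c ≡ᵇ 0) ∧ S (d ℕ./ c) then 1 else 0

finProd-factorPower : ∀ S c′ K →
  finProd S (λ m → suc c′ ℕ.* m) K ≗ factorPower (multiplicity S (suc c′)) (suc c′ ℕ.* K)
finProd-factorPower S c′ zero    rewrite ℕP.*-zeroʳ c′ = λ _ → refl
finProd-factorPower S c′ (suc K) = begin
  finProd S (c ℕ.*_) (suc K)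
    ≈⟨ last-block (S (suc K)) refl ⟨
  finProd S (c ℕ.*_) K ⊛ factor (c ℕ.* suc K) ^ μ (c ℕ.* suc K)
    ≈⟨ ⊛-cong (finProd-factorPower S c′ K) (λ n → cong (λ d → (factor d ^ μ d) n) (sym index)) ⟩
  factorPower μ (c ℕ.* K) ⊛ g (c ℕ.* K ℕ.+ c′)
    ≈⟨ ⊛-congˡ (factorPower μ (c ℕ.* K)) (⊛-identityˡ (g (c ℕ.* K ℕ.+ c′))) ⟨
  factorPower μ (c ℕ.* K) ⊛ (oneP ⊛ g (c ℕ.* K ℕ.+ c′))
    ≈⟨ ⊛-congˡ (factorPower μ (c ℕ.* K)) (⊛-congʳ (g (c ℕ.* K ℕ.+ c′)) (∏.identity c′ (λ i i<c′ _ → cong (λ k → (factor _ ^ k) _) (μ-zero i i<c′)))) ⟨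
  factorPower μ (c ℕ.* K) ⊛ ∏ (λ i → g (c ℕ.* K ℕ.+ i)) c
    ≈⟨ ∏.split g (c ℕ.* K) c ⟨
  factorPower μ (c ℕ.* K ℕ.+ c)
    ≡⟨ cong (factorPower μ) (trans (ℕP.+-comm (c ℕ.* K) c) (sym (ℕP.*-suc c K))) ⟩
  factorPower μ (c ℕ.* suc K) ∎
  where
  open ≗-Reasoning
  c = suc c′
  μ = multiplicity S c
  g : ℕ → PS
  g i = factor (suc i) ^ μ (suc i)
  index : suc (c ℕ.* K ℕ.+ c′) ≡ c ℕ.* suc K
  index = trans (cong suc (ℕP.+-comm (c ℕ.* K) c′)) (sym (ℕP.*-suc c K))
  μ-zero : ∀ i → i ℕ.< c′ → μ (suc (c ℕ.* K ℕ.+ i)) ≡ 0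
  μ-zero i i<c′ = cong (λ r → if (r ≡ᵇ 0) ∧ S (suc (c ℕ.* K ℕ.+ i) ℕ./ c) then 1 else 0) remainder
    where
    remainder : suc (c ℕ.* K ℕ.+ i) ℕ.% c ≡ suc i
    remainder = trans (cong (λ z → suc z ℕ.% c) (trans (ℕP.+-comm (c ℕ.* K) i) (cong (i ℕ.+_) (ℕP.*-comm c K))))
                      (trans (DM.[m+kn]%n≡m%n (suc i) K c) (DM.m<n⇒m%n≡m (s≤s i<c′)))
  μ-last : μ (c ℕ.* suc K) ≡ (if S (suc K) then 1 else 0)
  μ-last = trans (cong μ (ℕP.*-comm c (suc K)))
                 (cong₂ (λ r t → if (r ≡ᵇ 0) ∧ S t then 1 else 0) (DM.m*n%n≡0 (suc K) c) (DM.m*n/n≡m (suc K) c))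
  last-block : ∀ b → S (suc K) ≡ b →
    finProd S (c ℕ.*_) K ⊛ factor (c ℕ.* suc K) ^ μ (c ℕ.* suc K) ≗ finProd S (c ℕ.*_) (suc K)
  last-block b S≡b rewrite μ-last | S≡b with b
  ... | true  = ⊛-congˡ (finProd S (c ℕ.*_) K) (⊛-identityˡ (factor (c ℕ.* suc K)))
  ... | false = ⊛-identityʳ (finProd S (c ℕ.*_) K)

infProd-multiplicityProduct : ∀ S c′ → infProd S (λ m → suc c′ ℕ.* m) ≗ multiplicityProduct (multiplicity S (suc c′))
infProd-multiplicityProduct S c′ n =
  trans (finProd-factorPower S c′ n n)
        (coeff (factorPower-stable (multiplicity S (suc c′)) (suc c′ ℕ.* n) (ℕP.m≤m+n n (c′ ℕ.* n))) n ℕP.≤-refl)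

multiplicity-mod : ∀ S c k .{{_ : NonZero c}} .{{_ : NonZero k}} {{_ : NonZero (k ℕ.* c)}} →
  (∀ m → S (m ℕ.% k) ≡ S m) → ∀ d → multiplicity S c d ≡ multiplicity S c (d ℕ.% (k ℕ.* c))
multiplicity-mod S c k S-periodic d = cong₂ (λ r t → if (r ≡ᵇ 0) ∧ t then 1 else 0)
  (sym (DM.m∣n⇒o%n%m≡o%m c (k ℕ.* c) d (divides k refl)))
  (sym (trans (cong S (DM.m%[n*o]/o≡m/o%n d k c)) (S-periodic (d ℕ./ c))))

agree-mod : ∀ (f g : ℕ → ℕ) p .{{_ : NonZero p}} → (∀ d → f d ≡ f (d ℕ.% p)) → (∀ d → g d ≡ g (d ℕ.% p)) →
  (∀ (r : Fin p) → f (Fin.toℕ r) ≡ g (Fin.toℕ r)) → ∀ d → f d ≡ g d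
agree-mod f g p f-periodic g-periodic f≡g d = begin
  f d                                 ≡⟨ f-periodic d ⟩
  f (d ℕ.% p)                         ≡⟨ cong f (FinP.toℕ-fromℕ< (DM.m%n<n d p)) ⟨
  f (Fin.toℕ (Fin.fromℕ< (DM.m%n<n d p))) ≡⟨ f≡g (Fin.fromℕ< (DM.m%n<n d p)) ⟩
  g (Fin.toℕ (Fin.fromℕ< (DM.m%n<n d p))) ≡⟨ cong g (FinP.toℕ-fromℕ< (DM.m%n<n d p)) ⟩
  g (d ℕ.% p)                         ≡⟨ g-periodic d ⟨
  g d                                 ∎
  where open ≡-Reasoning

finProd-split : ∀ S e base → (∀ j → S (j ℕ.+ base) ≡ S j) → ∀ r →
  finProd S e (r ℕ.+ base) ≗ finProd S e base ⊛ finProd S (λ j → e (j ℕ.+ base)) r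
finProd-split S e base S-shift zero    = λ n → sym (⊛-identityʳ (finProd S e base) n)
finProd-split S e base S-shift (suc r) with S (suc r ℕ.+ base) | S (suc r) | S-shift (suc r)
... | true  | true  | _ = λ n → trans (⊛-congʳ (factor (e (suc r ℕ.+ base))) (finProd-split S e base S-shift r) n)
                                      (⊛-assoc (finProd S e base) (finProd S (λ j → e (j ℕ.+ base)) r) (factor (e (suc r ℕ.+ base))) n)
... | false | false | _ = finProd-split S e base S-shift r

finProd-periodic : ∀ S e p → (∀ j k → S (j ℕ.+ k ℕ.* p) ≡ S j) → ∀ n →
  finProd S e (n ℕ.* p) ≗ ∏ (λ k → finProd S (λ j → e (j ℕ.+ k ℕ.* p)) p) n
finProd-periodic S e p S-periodic zero    = λ _ → refl
finProd-periodic S e p S-periodic (suc n) = begin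
  finProd S e (p ℕ.+ n ℕ.* p)
    ≈⟨ finProd-split S e (n ℕ.* p) (λ j → S-periodic j n) p ⟩
  finProd S e (n ℕ.* p) ⊛ finProd S (λ j → e (j ℕ.+ n ℕ.* p)) p
    ≈⟨ ⊛-congʳ (finProd S (λ j → e (j ℕ.+ n ℕ.* p)) p) (finProd-periodic S e p S-periodic n) ⟩
  ∏ (λ k → finProd S (λ j → e (j ℕ.+ k ℕ.* p)) p) (suc n) ∎
  where open ≗-Reasoning

factor-1* : ∀ a → factor (1 ℕ.* a) ≗ oneP +ₚ monomial -[1+ 0 ] a
factor-1* a n = trans (factor≗ (1 ℕ.* a) n)
  (cong (λ z → oneP n + z) (trans (cong (λ e → - (x^ e) n) (ℕP.*-identityˡ a)) (sym (monomial-neg (+ 1) a n))))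

factor-double : ∀ a → (oneP +ₚ x^ a) ⊛ factor (1 ℕ.* a) ≗ factor (2 ℕ.* a)
factor-double a = begin
  (oneP +ₚ x^ a) ⊛ factor (1 ℕ.* a)
    ≈⟨ ⊛-congˡ (oneP +ₚ x^ a) (λ n → trans (factor-1* a n) (cong (λ z → oneP n + z) (monomial-neg (+ 1) a n))) ⟩
  (oneP +ₚ x^ a) ⊛ (oneP +ₚ -ₚ x^ a)
    ≈⟨ solve 1 (λ X → (one :+ X) :* (one :+ :- X) := one :+ :- (X :* X)) (λ _ → refl) (x^ a) ⟩
  oneP +ₚ -ₚ (x^ a ⊛ x^ a)
    ≈⟨ +ₚ-congˡ oneP (λ n → cong -_ (trans (monomial-⊛-monomial (+ 1) a (+ 1) a n)
                                                     (cong (λ e → (x^ e) n) (cong (a ℕ.+_) (sym (ℕP.+-identityʳ a)))))) ⟩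
  oneP +ₚ -ₚ x^ (2 ℕ.* a)                       ≈⟨ factor≗ (2 ℕ.* a) ⟨
  factor (2 ℕ.* a)                              ∎
  where open ≗-Reasoning
        one = con (+ 1)

finProd-all : ∀ e n → finProd (λ _ → true) e n ≗ ∏ (λ k → factor (e (suc k))) n
finProd-all e zero    = λ _ → refl
finProd-all e (suc n) = ⊛-congʳ (factor (e (suc n))) (finProd-all e n)

-- The Jacobi triple product

triangular-+ : ∀ a b → triangular (a ℕ.+ b) ≡ triangular a ℕ.+ triangular b ℕ.+ a ℕ.* b
triangular-+ a zero    rewrite ℕP.+-identityʳ a | ℕP.*-zeroʳ a =
  sym (trans (ℕP.+-identityʳ (triangular a ℕ.+ 0)) (ℕP.+-identityʳ (triangular a)))
triangular-+ a (suc b) rewrite ℕP.+-suc a b | triangular-+ a b = regroup (triangular a) (triangular b) a b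
  where
  regroup : ∀ x y a b → x ℕ.+ y ℕ.+ a ℕ.* b ℕ.+ (a ℕ.+ b) ≡ x ℕ.+ (y ℕ.+ b) ℕ.+ a ℕ.* suc b
  regroup = ℕ-Solver.solve-∀

triangular-double : ∀ t → triangular (suc t) ℕ.+ triangular (suc t) ≡ suc t ℕ.* t
triangular-double zero    = refl
triangular-double (suc t) = begin
  (triangular t ℕ.+ t ℕ.+ suc t) ℕ.+ (triangular t ℕ.+ t ℕ.+ suc t)
    ≡⟨ regroup (triangular t) t ⟩
  (triangular t ℕ.+ t ℕ.+ (triangular t ℕ.+ t)) ℕ.+ (suc t ℕ.+ suc t)
    ≡⟨ cong (ℕ._+ (suc t ℕ.+ suc t)) (triangular-double t) ⟩
  suc t ℕ.* t ℕ.+ (suc t ℕ.+ suc t)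
    ≡⟨ expand t ⟩
  suc (suc t) ℕ.* suc t ∎
  where
  open ≡-Reasoning
  regroup : ∀ x t → x ℕ.+ t ℕ.+ suc t ℕ.+ (x ℕ.+ t ℕ.+ suc t) ≡ (x ℕ.+ t ℕ.+ (x ℕ.+ t)) ℕ.+ (suc t ℕ.+ suc t)
  regroup = ℕ-Solver.solve-∀
  expand : ∀ t → suc t ℕ.* t ℕ.+ (suc t ℕ.+ suc t) ≡ suc (suc t) ℕ.* suc t
  expand = ℕ-Solver.solve-∀

∸-elim : ∀ (P : ℕ → ℕ → Set) {t m} → t ℕ.≤ m → (∀ r → P (t ℕ.+ r) r) → P m (m ∸ t)
∸-elim P {t} {m} t≤m P[t+r,r] = subst (λ z → P z (m ∸ t)) (ℕP.m+[n∸m]≡n t≤m) (P[t+r,r] (m ∸ t))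

module TripleProductExponents (α β : ℕ) .{{_ : NonZero α}} .{{_ : NonZero β}} where

  N : ℕ
  N = α ℕ.+ β

  instance
    N-nonZero : NonZero N
    N-nonZero = ℕ.>-nonZero (ℕP.<-≤-trans (ℕ.>-nonZero⁻¹ α) (ℕP.m≤m+n α β))

  -- In the binomial expansion at level m the two parameters are x^(w m) and s, with q = x^N.
  w : ℕ → ℕ
  w m = m ℕ.* N ℕ.+ β

  termExponent : ℕ → ℕ → ℕ
  termExponent m j = triangular j ℕ.* N ℕ.+ ((suc m ℕ.+ suc m) ∸ j) ℕ.* w m

  centreExponent : ℕ → ℕ
  centreExponent m = triangular (suc m) ℕ.* N ℕ.+ suc m ℕ.* w m

  e₊ e₋ : ℕ → ℕ
  e₊ t = α ℕ.* t ℕ.+ triangular t ℕ.* N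
  e₋ t = β ℕ.* t ℕ.+ triangular t ℕ.* N

  termExponent-centre : ∀ m → termExponent m (suc m) ≡ centreExponent m
  termExponent-centre m = cong (λ z → triangular (suc m) ℕ.* N ℕ.+ z ℕ.* w m) (ℕP.m+n∸m≡n (suc m) (suc m))

  termExponent-above : ∀ m t → t ℕ.≤ m → termExponent m (suc (suc m) ℕ.+ t) ≡ centreExponent m ℕ.+ e₊ (suc t)
  termExponent-above m t t≤m = trans (cong (termExponent m) (sym (ℕP.+-suc (suc m) t)))
    (∸-elim (λ m _ → termExponent m (suc m ℕ.+ suc t) ≡ centreExponent m ℕ.+ e₊ (suc t)) t≤m go)
    where
    regroup : ∀ t r a b X Y → let n = t ℕ.+ r ; N = a ℕ.+ b in
      (X ℕ.+ Y ℕ.+ suc n ℕ.* suc t) ℕ.* N ℕ.+ r ℕ.* (n ℕ.* N ℕ.+ b)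
        ≡ (X ℕ.* N ℕ.+ suc n ℕ.* (n ℕ.* N ℕ.+ b)) ℕ.+ (a ℕ.* suc t ℕ.+ Y ℕ.* N)
    regroup = ℕ-Solver.solve-∀
    go : ∀ r → termExponent (t ℕ.+ r) (suc (t ℕ.+ r) ℕ.+ suc t) ≡ centreExponent (t ℕ.+ r) ℕ.+ e₊ (suc t)
    go r = begin
      triangular (suc n ℕ.+ suc t) ℕ.* N ℕ.+ ((suc n ℕ.+ suc n) ∸ (suc n ℕ.+ suc t)) ℕ.* w n
        ≡⟨ cong₂ (λ y z → y ℕ.* N ℕ.+ z ℕ.* w n) (triangular-+ (suc n) (suc t))
                 (trans (ℕP.[m+n]∸[m+o]≡n∸o (suc n) (suc n) (suc t)) (ℕP.m+n∸m≡n t r)) ⟩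
      (triangular (suc n) ℕ.+ triangular (suc t) ℕ.+ suc n ℕ.* suc t) ℕ.* N ℕ.+ r ℕ.* w n
        ≡⟨ regroup t r α β (triangular (suc n)) (triangular (suc t)) ⟩
      centreExponent n ℕ.+ e₊ (suc t) ∎
      where open ≡-Reasoning
            n = t ℕ.+ r

  termExponent-below : ∀ m t → t ℕ.≤ m → termExponent m (m ∸ t) ≡ centreExponent m ℕ.+ e₋ (suc t)
  termExponent-below m t t≤m = ∸-elim (λ m z → termExponent m z ≡ centreExponent m ℕ.+ e₋ (suc t)) t≤m go
    where
    twice-centre : ∀ t r → suc (t ℕ.+ r) ℕ.+ suc (t ℕ.+ r) ≡ r ℕ.+ (suc t ℕ.+ suc (t ℕ.+ r))
    twice-centre = ℕ-Solver.solve-∀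
    regroup₁ : ∀ t r a b X Y → let n = t ℕ.+ r ; N = a ℕ.+ b in
      (X ℕ.+ Y ℕ.+ r ℕ.* suc t) ℕ.* N ℕ.+ suc n ℕ.* (n ℕ.* N ℕ.+ b) ℕ.+ (b ℕ.* suc t ℕ.+ Y ℕ.* N)
        ≡ (X ℕ.* N ℕ.+ suc n ℕ.* (n ℕ.* N ℕ.+ b) ℕ.+ r ℕ.* suc t ℕ.* N ℕ.+ b ℕ.* suc t) ℕ.+ (Y ℕ.+ Y) ℕ.* N
    regroup₁ = ℕ-Solver.solve-∀
    regroup₂ : ∀ t r a b X → let n = t ℕ.+ r ; N = a ℕ.+ b in
      (X ℕ.* N ℕ.+ suc n ℕ.* (n ℕ.* N ℕ.+ b) ℕ.+ r ℕ.* suc t ℕ.* N ℕ.+ b ℕ.* suc t) ℕ.+ suc t ℕ.* t ℕ.* N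
        ≡ X ℕ.* N ℕ.+ (suc t ℕ.+ suc n) ℕ.* (n ℕ.* N ℕ.+ b)
    regroup₂ = ℕ-Solver.solve-∀
    go : ∀ r → termExponent (t ℕ.+ r) r ≡ centreExponent (t ℕ.+ r) ℕ.+ e₋ (suc t)
    go r = sym (begin
      triangular (suc n) ℕ.* N ℕ.+ suc n ℕ.* w n ℕ.+ (β ℕ.* suc t ℕ.+ triangular (suc t) ℕ.* N)
        ≡⟨ cong (λ z → z ℕ.* N ℕ.+ suc n ℕ.* w n ℕ.+ (β ℕ.* suc t ℕ.+ triangular (suc t) ℕ.* N))
                (trans (cong triangular (ℕP.+-comm (suc t) r)) (triangular-+ r (suc t))) ⟩
      (triangular r ℕ.+ triangular (suc t) ℕ.+ r ℕ.* suc t) ℕ.* N ℕ.+ suc n ℕ.* w n ℕ.+ (β ℕ.* suc t ℕ.+ triangular (suc t) ℕ.* N)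
        ≡⟨ regroup₁ t r α β (triangular r) (triangular (suc t)) ⟩
      rest ℕ.+ (triangular (suc t) ℕ.+ triangular (suc t)) ℕ.* N
        ≡⟨ cong (λ z → rest ℕ.+ z ℕ.* N) (triangular-double t) ⟩
      rest ℕ.+ suc t ℕ.* t ℕ.* N
        ≡⟨ regroup₂ t r α β (triangular r) ⟩
      triangular r ℕ.* N ℕ.+ (suc t ℕ.+ suc n) ℕ.* w n
        ≡⟨ cong (λ z → triangular r ℕ.* N ℕ.+ z ℕ.* w n)
                (sym (trans (cong (_∸ r) (twice-centre t r)) (ℕP.m+n∸m≡n r (suc t ℕ.+ suc n)))) ⟩
      termExponent n r ∎)
      where open ≡-Reasoning
            n = t ℕ.+ r
            rest = triangular r ℕ.* N ℕ.+ suc n ℕ.* w n ℕ.+ r ℕ.* suc t ℕ.* N ℕ.+ β ℕ.* suc t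

  upper-factor-exponent : ∀ m k → w m ℕ.+ (α ℕ.+ k ℕ.* N) ≡ (suc m ℕ.+ k) ℕ.* N
  upper-factor-exponent m k = regroup m k α β
    where
    regroup : ∀ m k a b → m ℕ.* (a ℕ.+ b) ℕ.+ b ℕ.+ (a ℕ.+ k ℕ.* (a ℕ.+ b)) ≡ (suc m ℕ.+ k) ℕ.* (a ℕ.+ b)
    regroup = ℕ-Solver.solve-∀

  lower-factor-exponent : ∀ m i → i ℕ.≤ m → i ℕ.* N ℕ.+ (β ℕ.+ (m ∸ i) ℕ.* N) ≡ w m
  lower-factor-exponent m i i≤m = ∸-elim (λ m z → i ℕ.* N ℕ.+ (β ℕ.+ z ℕ.* N) ≡ w m) i≤m (λ r → regroup i r α β)
    where
    regroup : ∀ i r a b → i ℕ.* (a ℕ.+ b) ℕ.+ (b ℕ.+ r ℕ.* (a ℕ.+ b)) ≡ (i ℕ.+ r) ℕ.* (a ℕ.+ b) ℕ.+ b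
    regroup = ℕ-Solver.solve-∀

  e₊-≥ : ∀ t → suc t ℕ.≤ e₊ (suc t)
  e₊-≥ t = ℕP.≤-trans (ℕP.m≤n*m (suc t) α) (ℕP.m≤m+n (α ℕ.* suc t) _)

  e₋-≥ : ∀ t → suc t ℕ.≤ e₋ (suc t)
  e₋-≥ t = ℕP.≤-trans (ℕP.m≤n*m (suc t) β) (ℕP.m≤m+n (β ℕ.* suc t) _)

∏-monomial : ∀ c N n → ∏ (λ i → monomial c (i ℕ.* N)) n ≗ monomial (c ℤ.^ n) (triangular n ℕ.* N)
∏-monomial c N zero    = oneP≗x^0
∏-monomial c N (suc n) = begin
  ∏ (λ i → monomial c (i ℕ.* N)) n ⊛ monomial c (n ℕ.* N)
    ≈⟨ ⊛-congʳ (monomial c (n ℕ.* N)) (∏-monomial c N n) ⟩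
  monomial (c ℤ.^ n) (triangular n ℕ.* N) ⊛ monomial c (n ℕ.* N)
    ≈⟨ monomial-⊛-monomial (c ℤ.^ n) (triangular n ℕ.* N) c (n ℕ.* N) ⟩
  monomial (c ℤ.^ n * c) (triangular n ℕ.* N ℕ.+ n ℕ.* N)          ≈⟨ monomial-cong (ℤP.*-comm (c ℤ.^ n) c)
                                                                         (sym (ℕP.*-distribʳ-+ N (triangular n) n)) ⟩
  monomial (c ℤ.^ suc n) (triangular (suc n) ℕ.* N)                 ∎
  where open ≗-Reasoning

^-unit : ∀ {s} → s * s ≡ + 1 → ∀ n → s ℤ.^ n * s ℤ.^ n ≡ + 1
^-unit s²≡1 zero    = refl
^-unit {s} s²≡1 (suc n) = trans (ℤ*.interchange s (s ℤ.^ n) s (s ℤ.^ n)) (cong₂ _*_ s²≡1 (^-unit s²≡1 n))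
  where module ℤ* = CommutativeSemigroupProperties ℤP.*-commutativeSemigroup

unit-^-∸ : ∀ {s} → s * s ≡ + 1 → ∀ {m t} → t ℕ.≤ m → s ℤ.^ suc m * s ℤ.^ suc t ≡ s ℤ.^ (m ∸ t)
unit-^-∸ {s} s²≡1 {m} {t} t≤m = begin
  s ℤ.^ suc m * s ℤ.^ suc t                        ≡⟨ cong (λ e → s ℤ.^ e * s ℤ.^ suc t) 1+m≡[m∸t]+[1+t] ⟩
  s ℤ.^ ((m ∸ t) ℕ.+ suc t) * s ℤ.^ suc t          ≡⟨ cong (_* s ℤ.^ suc t) (ℤP.^-distribˡ-+-* s (m ∸ t) (suc t)) ⟩
  s ℤ.^ (m ∸ t) * s ℤ.^ suc t * s ℤ.^ suc t        ≡⟨ ℤP.*-assoc (s ℤ.^ (m ∸ t)) _ _ ⟩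
  s ℤ.^ (m ∸ t) * (s ℤ.^ suc t * s ℤ.^ suc t)      ≡⟨ cong (s ℤ.^ (m ∸ t) *_) (^-unit {s} s²≡1 (suc t)) ⟩
  s ℤ.^ (m ∸ t) * + 1                              ≡⟨ ℤP.*-identityʳ _ ⟩
  s ℤ.^ (m ∸ t)                                    ∎
  where
  open ≡-Reasoning
  1+m≡[m∸t]+[1+t] : suc m ≡ (m ∸ t) ℕ.+ suc t
  1+m≡[m∸t]+[1+t] = sym (trans (ℕP.+-suc (m ∸ t) t) (cong suc (ℕP.m∸n+n≡m t≤m)))

module JacobiTripleProduct (α β : ℕ) .{{_ : NonZero α}} .{{_ : NonZero β}} (s : ℤ) (s²≡1 : s * s ≡ + 1) where
  open TripleProductExponents α β

  q : PS
  q = x^ N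

  upperFactor lowerFactor : ℕ → PS
  upperFactor k = oneP +ₚ monomial s (α ℕ.+ k ℕ.* N)
  lowerFactor k = oneP +ₚ monomial s (β ℕ.+ k ℕ.* N)

  tripleProduct : ℕ → PS
  tripleProduct n = ∏ upperFactor n ⊛ ∏ lowerFactor n

  η∞ : PS
  η∞ = infProd (λ _ → true) (λ k → N ℕ.* k)

  thetaTerm : ℕ → PS
  thetaTerm t = monomial (s ℤ.^ suc t) (e₊ (suc t)) +ₚ monomial (s ℤ.^ suc t) (e₋ (suc t))

  thetaPartial : ℕ → PS
  thetaPartial K = oneP +ₚ ∑ thetaTerm K

  -- Σ_{t ∈ ℤ} s^t x^(α t + N t(t-1)/2), the terms t and -t being paired in thetaTerm.
  θ : PS
  θ d = thetaPartial (suc d) d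

  private
    u : ℕ → PS
    u m = x^ (w m)

    v : PS
    v = monomial s 0

    v⊛q^ : ∀ i → v ⊛ q ^ i ≗ monomial s (i ℕ.* N)
    v⊛q^ i = begin
      v ⊛ q ^ i                                  ≈⟨ ⊛-congˡ v (x^-^ N i) ⟩
      monomial s 0 ⊛ monomial (+ 1) (i ℕ.* N)    ≈⟨ monomial-⊛-monomial s 0 (+ 1) (i ℕ.* N) ⟩
      monomial (s * + 1) (i ℕ.* N)               ≈⟨ monomial-cong {j = i ℕ.* N} (ℤP.*-identityʳ s) refl ⟩
      monomial s (i ℕ.* N)                       ∎
      where open ≗-Reasoning

    ⊛-oneP+ₚ : ∀ a b → a ⊛ (oneP +ₚ b) ≗ a +ₚ a ⊛ b
    ⊛-oneP+ₚ a b = begin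
      a ⊛ (oneP +ₚ b)          ≈⟨ ⊛-distribˡ a oneP b ⟩
      a ⊛ oneP +ₚ a ⊛ b        ≈⟨ +ₚ-congʳ (a ⊛ b) (⊛-identityʳ a) ⟩
      a +ₚ a ⊛ b               ∎
      where open ≗-Reasoning

    upper-binomialFactor : ∀ m k → u m +ₚ v ⊛ q ^ (suc m ℕ.+ k) ≗ u m ⊛ upperFactor k
    upper-binomialFactor m k = begin
      u m +ₚ v ⊛ q ^ (suc m ℕ.+ k)                  ≈⟨ +ₚ-congˡ (u m) (v⊛q^ (suc m ℕ.+ k)) ⟩
      u m +ₚ monomial s ((suc m ℕ.+ k) ℕ.* N)
        ≈⟨ +ₚ-congˡ (u m) (monomial-cong (ℤP.*-identityˡ s) (upper-factor-exponent m k)) ⟨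
      u m +ₚ monomial (+ 1 * s) (w m ℕ.+ (α ℕ.+ k ℕ.* N))
                                                     ≈⟨ +ₚ-congˡ (u m) (monomial-⊛-monomial (+ 1) (w m) s (α ℕ.+ k ℕ.* N)) ⟨
      u m +ₚ u m ⊛ monomial s (α ℕ.+ k ℕ.* N)        ≈⟨ ⊛-oneP+ₚ (u m) (monomial s (α ℕ.+ k ℕ.* N)) ⟨
      u m ⊛ upperFactor k                            ∎
      where open ≗-Reasoning

    lower-binomialFactor : ∀ m i → i ℕ.≤ m → u m +ₚ v ⊛ q ^ i ≗ monomial s (i ℕ.* N) ⊛ lowerFactor (m ∸ i)
    lower-binomialFactor m i i≤m = begin
      u m +ₚ v ⊛ q ^ i                        ≈⟨ +ₚ-congˡ (u m) (v⊛q^ i) ⟩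
      u m +ₚ monomial s (i ℕ.* N)             ≈⟨ +ₚ-comm (u m) (monomial s (i ℕ.* N)) ⟩
      monomial s (i ℕ.* N) +ₚ u m
        ≈⟨ +ₚ-congˡ (monomial s (i ℕ.* N)) (monomial-cong s²≡1 (lower-factor-exponent m i i≤m)) ⟨
      monomial s (i ℕ.* N) +ₚ monomial (s * s) (i ℕ.* N ℕ.+ (β ℕ.+ (m ∸ i) ℕ.* N))
                                               ≈⟨ +ₚ-congˡ (monomial s (i ℕ.* N)) (monomial-⊛-monomial s (i ℕ.* N) s _) ⟨
      monomial s (i ℕ.* N) +ₚ monomial s (i ℕ.* N) ⊛ monomial s (β ℕ.+ (m ∸ i) ℕ.* N)
                                               ≈⟨ ⊛-oneP+ₚ (monomial s (i ℕ.* N)) (monomial s (β ℕ.+ (m ∸ i) ℕ.* N)) ⟨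
      monomial s (i ℕ.* N) ⊛ lowerFactor (m ∸ i) ∎
      where open ≗-Reasoning

    centre : ℕ → PS
    centre m = monomial (s ℤ.^ suc m) (centreExponent m)

    binomialProduct-factorisation : ∀ m →
      ∏ (λ i → u m +ₚ v ⊛ q ^ i) (suc m ℕ.+ suc m) ≗ centre m ⊛ tripleProduct (suc m)
    binomialProduct-factorisation m = begin
      ∏ f (suc m ℕ.+ suc m)
        ≈⟨ ∏.split f (suc m) (suc m) ⟩
      ∏ f (suc m) ⊛ ∏ (λ k → f (suc m ℕ.+ k)) (suc m)
        ≈⟨ ⊛-cong (∏.cong-< (suc m) (λ i i<sm → lower-binomialFactor m i (ℕP.≤-pred i<sm)))
                  (∏-cong (suc m) (upper-binomialFactor m)) ⟩
      ∏ (λ i → monomial s (i ℕ.* N) ⊛ lowerFactor (m ∸ i)) (suc m) ⊛ ∏ (λ k → u m ⊛ upperFactor k) (suc m)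
        ≈⟨ ⊛-cong (∏.homo _ (λ i → lowerFactor (m ∸ i)) (suc m)) (∏.homo (λ _ → u m) upperFactor (suc m)) ⟩
      (∏ (λ i → monomial s (i ℕ.* N)) (suc m) ⊛ ∏ (λ i → lowerFactor (m ∸ i)) (suc m))
        ⊛ (u m ^ suc m ⊛ ∏ upperFactor (suc m))
        ≈⟨ ⊛-cong (⊛-cong (∏-monomial s N (suc m)) (∏.reverse lowerFactor (suc m)))
                  (⊛-congʳ (∏ upperFactor (suc m)) (x^-^ (w m) (suc m))) ⟩
      (monomial (s ℤ.^ suc m) (triangular (suc m) ℕ.* N) ⊛ ∏ lowerFactor (suc m))
        ⊛ (x^ (suc m ℕ.* w m) ⊛ ∏ upperFactor (suc m))
        ≈⟨ solve 4 (λ a b c d → (a :* b) :* (c :* d) := (a :* c) :* (d :* b)) (λ _ → refl)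
                 (monomial (s ℤ.^ suc m) (triangular (suc m) ℕ.* N)) (∏ lowerFactor (suc m))
                 (x^ (suc m ℕ.* w m)) (∏ upperFactor (suc m)) ⟩
      (monomial (s ℤ.^ suc m) (triangular (suc m) ℕ.* N) ⊛ x^ (suc m ℕ.* w m)) ⊛ tripleProduct (suc m)
        ≈⟨ ⊛-congʳ (tripleProduct (suc m)) (λ n →
             trans (monomial-⊛-monomial (s ℤ.^ suc m) (triangular (suc m) ℕ.* N) (+ 1) (suc m ℕ.* w m) n)
                   (monomial-cong {j = centreExponent m} (ℤP.*-identityʳ (s ℤ.^ suc m)) refl n)) ⟩
      centre m ⊛ tripleProduct (suc m) ∎
      where
      open ≗-Reasoning
      f : ℕ → PS
      f i = u m +ₚ v ⊛ q ^ i

    binomialTerm-monomial : ∀ m j → let M₂ = suc m ℕ.+ suc m in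
      binomialTerm q (u m) v M₂ j ≗ monomial (s ℤ.^ j) (termExponent m j) ⊛ gaussian q M₂ j
    binomialTerm-monomial m j = begin
      gaussian q M₂ j ⊛ (q ^ triangular j ⊛ (v ^ j ⊛ u m ^ (M₂ ∸ j)))
        ≈⟨ ⊛-congˡ (gaussian q M₂ j) (⊛-cong (x^-^ N (triangular j)) (⊛-cong (monomial-^ s 0 j) (x^-^ (w m) (M₂ ∸ j)))) ⟩
      gaussian q M₂ j ⊛ (x^ (triangular j ℕ.* N) ⊛ (monomial (s ℤ.^ j) (j ℕ.* 0) ⊛ x^ ((M₂ ∸ j) ℕ.* w m)))
        ≈⟨ ⊛-congˡ (gaussian q M₂ j) (⊛-congˡ (x^ (triangular j ℕ.* N))
             (monomial-⊛-monomial (s ℤ.^ j) (j ℕ.* 0) (+ 1) ((M₂ ∸ j) ℕ.* w m))) ⟩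
      gaussian q M₂ j ⊛ (x^ (triangular j ℕ.* N) ⊛ monomial (s ℤ.^ j * + 1) (j ℕ.* 0 ℕ.+ (M₂ ∸ j) ℕ.* w m))
        ≈⟨ ⊛-congˡ (gaussian q M₂ j) (monomial-⊛-monomial (+ 1) (triangular j ℕ.* N) (s ℤ.^ j * + 1) _) ⟩
      gaussian q M₂ j ⊛ monomial (+ 1 * (s ℤ.^ j * + 1)) (triangular j ℕ.* N ℕ.+ (j ℕ.* 0 ℕ.+ (M₂ ∸ j) ℕ.* w m))
        ≈⟨ ⊛-congˡ (gaussian q M₂ j) (monomial-cong (trans (ℤP.*-identityˡ _) (ℤP.*-identityʳ (s ℤ.^ j)))
             (cong (λ z → triangular j ℕ.* N ℕ.+ (z ℕ.+ (M₂ ∸ j) ℕ.* w m)) (ℕP.*-zeroʳ j))) ⟩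
      gaussian q M₂ j ⊛ monomial (s ℤ.^ j) (termExponent m j)
        ≈⟨ ⊛-comm (gaussian q M₂ j) (monomial (s ℤ.^ j) (termExponent m j)) ⟩
      monomial (s ℤ.^ j) (termExponent m j) ⊛ gaussian q M₂ j ∎
      where open ≗-Reasoning
            M₂ = suc m ℕ.+ suc m

    finProd-qPochhammer : ∀ K → finProd (λ _ → true) (λ k → N ℕ.* k) K ≗ qPochhammer q K
    finProd-qPochhammer zero    = λ _ → refl
    finProd-qPochhammer (suc K) = ⊛-cong (finProd-qPochhammer K) (λ n → trans (factor≗ (N ℕ.* suc K) n)
      (cong (λ z → oneP n + - z) (sym (trans (x^-^ N (suc K) n) (cong (λ e → (x^ e) n) (ℕP.*-comm (suc K) N))))))

    η∞-≗[]-qPochhammer : ∀ {M} K → M ℕ.≤ K → η∞ ≗[ M ] qPochhammer q K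
    η∞-≗[]-qPochhammer {M} K M≤K = begin
      η∞                                     ≈⟨ infProd-≗[]-finProd (λ _ → true) (λ k → N ℕ.* k) (k≤c*k N) K M≤K ⟩
      finProd (λ _ → true) (λ k → N ℕ.* k) K ≈⟨ ≗⇒≗[] M (finProd-qPochhammer K) ⟩
      qPochhammer q K                        ∎
      where open ≗[]-Reasoning M

    -- η∞ agrees with (q; q)_k up to degree k, and [M₂, j] (q; q)_j (q; q)_(M₂-j) = (q; q)_M₂.
    gaussian-≗[]-oneP : ∀ {M₂ j M} → M ℕ.≤ j → M ℕ.≤ M₂ ∸ j → j ℕ.≤ M₂ →
                        gaussian q M₂ j ⊛ η∞ ≗[ M ] oneP
    gaussian-≗[]-oneP {M₂} {j} {M} M≤j M≤M₂∸j j≤M₂ = begin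
      g ⊛ η∞                   ≈⟨ ≗⇒≗[] M (⊛-invPS-cancelʳ η∞ (g ⊛ η∞) refl) ⟨
      ((g ⊛ η∞) ⊛ η∞) ⊛ invPS η∞ ≈⟨ ⊛-congʳ-≗[] (invPS η∞) (⊛-cong-≗[] (⊛-congˡ-≗[] g (η∞-≗[]-qPochhammer j M≤j))
                                                                      (η∞-≗[]-qPochhammer (M₂ ∸ j) M≤M₂∸j)) ⟩
      ((g ⊛ qPochhammer q j) ⊛ qPochhammer q (M₂ ∸ j)) ⊛ invPS η∞
                               ≈⟨ ≗⇒≗[] M (⊛-congʳ (invPS η∞) (gaussian-qPochhammer q M₂ j j≤M₂)) ⟩
      qPochhammer q M₂ ⊛ invPS η∞ ≈⟨ ⊛-congʳ-≗[] (invPS η∞) (η∞-≗[]-qPochhammer M₂ (ℕP.≤-trans M≤j j≤M₂)) ⟨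
      η∞ ⊛ invPS η∞            ≈⟨ ≗⇒≗[] M (invPS-inverseʳ η∞ refl) ⟩
      oneP                     ∎
      where open ≗[]-Reasoning M
            g = gaussian q M₂ j

    termMonomial : ℕ → ℕ → PS
    termMonomial m j = monomial (s ℤ.^ j) (termExponent m j)

    binomialExpansion : ∀ m → let M₂ = suc m ℕ.+ suc m in
      centre m ⊛ (tripleProduct (suc m) ⊛ η∞) ≗ ∑ (λ j → termMonomial m j ⊛ (gaussian q M₂ j ⊛ η∞)) (suc M₂)
    binomialExpansion m = begin
      centre m ⊛ (tripleProduct (suc m) ⊛ η∞)
        ≈⟨ ⊛-assoc (centre m) (tripleProduct (suc m)) η∞ ⟨
      (centre m ⊛ tripleProduct (suc m)) ⊛ η∞
        ≈⟨ ⊛-congʳ η∞ (binomialProduct-factorisation m) ⟨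
      ∏ (λ i → u m +ₚ v ⊛ q ^ i) M₂ ⊛ η∞
        ≈⟨ ⊛-congʳ η∞ (q-binomial q (u m) v M₂) ⟩
      ∑ (binomialTerm q (u m) v M₂) (suc M₂) ⊛ η∞
        ≈⟨ ⊛-comm (∑ (binomialTerm q (u m) v M₂) (suc M₂)) η∞ ⟩
      η∞ ⊛ ∑ (binomialTerm q (u m) v M₂) (suc M₂)
        ≈⟨ ⊛-∑ η∞ (binomialTerm q (u m) v M₂) (suc M₂) ⟩
      ∑ (λ j → η∞ ⊛ binomialTerm q (u m) v M₂ j) (suc M₂)
        ≈⟨ ∑-cong (suc M₂) (λ j → begin
             η∞ ⊛ binomialTerm q (u m) v M₂ j                  ≈⟨ ⊛-congˡ η∞ (binomialTerm-monomial m j) ⟩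
             η∞ ⊛ (termMonomial m j ⊛ gaussian q M₂ j)        ≈⟨ ⊛.x∙yz≈y∙xz η∞ (termMonomial m j) (gaussian q M₂ j) ⟩
             termMonomial m j ⊛ (η∞ ⊛ gaussian q M₂ j)
               ≈⟨ ⊛-congˡ (termMonomial m j) (⊛-comm η∞ (gaussian q M₂ j)) ⟩
             termMonomial m j ⊛ (gaussian q M₂ j ⊛ η∞)        ∎) ⟩
      ∑ (λ j → termMonomial m j ⊛ (gaussian q M₂ j ⊛ η∞)) (suc M₂) ∎
      where open ≗-Reasoning
            M₂ = suc m ℕ.+ suc m

    -- Up to degree M above the centre, only the terms within M of the centre survive, and for
    -- them the Gaussian coefficient times η∞ is 1.
    binomialExpansion-≗[] : ∀ {M} m → M ℕ.+ M ℕ.≤ suc m → let M₂ = suc m ℕ.+ suc m in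
      ∑ (λ j → termMonomial m j ⊛ (gaussian q M₂ j ⊛ η∞)) (suc M₂)
        ≗[ centreExponent m ℕ.+ M ] ∑ (termMonomial m) (suc M₂)
    binomialExpansion-≗[] {M} m 2M≤n = begin
      ∑ F (suc (n ℕ.+ n))
        ≈⟨ ≗⇒≗[] D (∑.centred F n) ⟩
      F n +ₚ ∑ (λ t → F (suc n ℕ.+ t) +ₚ F (n ∸ suc t)) n
        ≈⟨ +ₚ-cong-≗[] centre-term (∑-≗[].cong-< D n (λ t t<n →
             +ₚ-cong-≗[] (term-above t (ℕP.≤-pred t<n)) (term-below t (ℕP.≤-pred t<n)))) ⟩
      termMonomial m n +ₚ ∑ (λ t → termMonomial m (suc n ℕ.+ t) +ₚ termMonomial m (n ∸ suc t)) n
        ≈⟨ ≗⇒≗[] D (∑.centred (termMonomial m) n) ⟨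
      ∑ (termMonomial m) (suc (n ℕ.+ n)) ∎
      where
      open ≗[]-Reasoning (centreExponent m ℕ.+ M)
      n = suc m
      M₂ = n ℕ.+ n
      D = centreExponent m ℕ.+ M
      F : ℕ → PS
      F j = termMonomial m j ⊛ (gaussian q M₂ j ⊛ η∞)
      M≤n : M ℕ.≤ n
      M≤n = ℕP.≤-trans (ℕP.m≤m+n M M) 2M≤n
      near : ∀ j → M ℕ.≤ j → M ℕ.≤ M₂ ∸ j → j ℕ.≤ M₂ → centreExponent m ℕ.≤ termExponent m j →
             F j ≗[ D ] termMonomial m j
      near j M≤j M≤M₂∸j j≤M₂ c≤e = ≗[]-mono (ℕP.+-monoˡ-≤ M c≤e) (≗[]-trans
        (monomial-⊛-cong-≗[] (s ℤ.^ j) (termExponent m j) (gaussian-≗[]-oneP M≤j M≤M₂∸j j≤M₂))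
        (≗⇒≗[] _ (⊛-identityʳ (termMonomial m j))))
      far : ∀ j → D ℕ.< termExponent m j → F j ≗[ D ] termMonomial m j
      far j D<e = ≗[]-trans (monomial-⊛-≗[]-zeroP (s ℤ.^ j) (gaussian q M₂ j ⊛ η∞) D<e)
                            (≗[]-sym (monomial-≗[]-zeroP (s ℤ.^ j) D<e))
      M≤m∸t : ∀ {t} → suc t ℕ.≤ M → M ℕ.≤ m ∸ t
      M≤m∸t {t} t<M = ℕP.m+n≤o⇒m≤o∸n M (ℕP.≤-pred (ℕP.≤-trans (ℕP.≤-reflexive (sym (ℕP.+-suc M t)))
                                                              (ℕP.≤-trans (ℕP.+-monoʳ-≤ M t<M) 2M≤n)))
      n≤M₂∸j : ∀ {j} → j ℕ.≤ n → n ℕ.≤ M₂ ∸ j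
      n≤M₂∸j {j} j≤n = subst (ℕ._≤ M₂ ∸ j) (ℕP.m+n∸m≡n n n) (ℕP.∸-monoʳ-≤ M₂ j≤n)
      centre-term : F n ≗[ D ] termMonomial m n
      centre-term = near n M≤n (ℕP.≤-trans M≤n (n≤M₂∸j ℕP.≤-refl)) (ℕP.m≤m+n n n)
                           (ℕP.≤-reflexive (sym (termExponent-centre m)))
      term-above : ∀ t → t ℕ.≤ m → F (suc n ℕ.+ t) ≗[ D ] termMonomial m (suc n ℕ.+ t)
      term-above t t≤m with suc t ℕ.≤? M
      ... | yes t<M = near (suc n ℕ.+ t) (ℕP.≤-trans M≤n (ℕP.≤-trans (ℕP.n≤1+n n) (ℕP.m≤m+n (suc n) t)))
                           (subst (M ℕ.≤_) (sym (trans (cong (M₂ ∸_) (sym (ℕP.+-suc n t))) (ℕP.[m+n]∸[m+o]≡n∸o n n (suc t))))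
                                  (M≤m∸t t<M))
                           (subst (ℕ._≤ M₂) (ℕP.+-suc n t) (ℕP.+-monoʳ-≤ n (s≤s t≤m)))
                           (subst (centreExponent m ℕ.≤_) (sym (termExponent-above m t t≤m)) (ℕP.m≤m+n _ _))
      ... | no  t≮M = far (suc n ℕ.+ t) (subst (D ℕ.<_) (sym (termExponent-above m t t≤m))
                            (ℕP.+-monoʳ-< (centreExponent m) (ℕP.<-≤-trans (ℕP.≰⇒> t≮M) (e₊-≥ t))))
      term-below : ∀ t → t ℕ.≤ m → F (n ∸ suc t) ≗[ D ] termMonomial m (n ∸ suc t)
      term-below t t≤m with suc t ℕ.≤? M
      ... | yes t<M = near (m ∸ t) (M≤m∸t t<M) (ℕP.≤-trans M≤n (n≤M₂∸j (ℕP.≤-trans (ℕP.m∸n≤m m t) (ℕP.n≤1+n m))))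
                           (ℕP.≤-trans (ℕP.m∸n≤m m t) (ℕP.≤-trans (ℕP.n≤1+n m) (ℕP.m≤m+n n n)))
                           (subst (centreExponent m ℕ.≤_) (sym (termExponent-below m t t≤m)) (ℕP.m≤m+n _ _))
      ... | no  t≮M = far (m ∸ t) (subst (D ℕ.<_) (sym (termExponent-below m t t≤m))
                            (ℕP.+-monoʳ-< (centreExponent m) (ℕP.<-≤-trans (ℕP.≰⇒> t≮M) (e₋-≥ t))))

    termMonomials-centred : ∀ m → ∑ (termMonomial m) (suc (suc m ℕ.+ suc m)) ≗ centre m ⊛ thetaPartial (suc m)
    termMonomials-centred m = begin
      ∑ (termMonomial m) (suc (n ℕ.+ n))
        ≈⟨ ∑.centred (termMonomial m) n ⟩
      termMonomial m n +ₚ ∑ (λ t → termMonomial m (suc n ℕ.+ t) +ₚ termMonomial m (n ∸ suc t)) n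
        ≈⟨ +ₚ-cong centre-term (∑.cong-< n (λ t t<n → ≗-trans (+ₚ-cong (term-above t (ℕP.≤-pred t<n)) (term-below t (ℕP.≤-pred t<n)))
                                                              (≗-sym (⊛-distribˡ (centre m) (monomial (s ℤ.^ suc t) (e₊ (suc t))) (monomial (s ℤ.^ suc t) (e₋ (suc t))))))) ⟩
      centre m ⊛ oneP +ₚ ∑ (λ t → centre m ⊛ thetaTerm t) n
        ≈⟨ +ₚ-congˡ (centre m ⊛ oneP) (⊛-∑ (centre m) thetaTerm n) ⟨
      centre m ⊛ oneP +ₚ centre m ⊛ ∑ thetaTerm n
        ≈⟨ ⊛-distribˡ (centre m) oneP (∑ thetaTerm n) ⟨
      centre m ⊛ thetaPartial n ∎
      where
      open ≗-Reasoning
      n = suc m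
      centre-term : termMonomial m n ≗ centre m ⊛ oneP
      centre-term = ≗-sym (≗-trans (⊛-identityʳ (centre m)) (monomial-cong refl (sym (termExponent-centre m))))
      centre-⊛ : ∀ c e → centre m ⊛ monomial c e ≗ monomial (s ℤ.^ n * c) (centreExponent m ℕ.+ e)
      centre-⊛ = monomial-⊛-monomial (s ℤ.^ n) (centreExponent m)
      term-above : ∀ t → t ℕ.≤ m → termMonomial m (suc n ℕ.+ t) ≗ centre m ⊛ monomial (s ℤ.^ suc t) (e₊ (suc t))
      term-above t t≤m = ≗-sym (≗-trans (centre-⊛ (s ℤ.^ suc t) (e₊ (suc t)))
        (monomial-cong (trans (sym (ℤP.^-distribˡ-+-* s n (suc t))) (cong (s ℤ.^_) (ℕP.+-suc n t)))
                       (sym (termExponent-above m t t≤m))))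
      term-below : ∀ t → t ℕ.≤ m → termMonomial m (n ∸ suc t) ≗ centre m ⊛ monomial (s ℤ.^ suc t) (e₋ (suc t))
      term-below t t≤m = ≗-sym (≗-trans (centre-⊛ (s ℤ.^ suc t) (e₋ (suc t)))
        (monomial-cong (unit-^-∸ s²≡1 t≤m) (sym (termExponent-below m t t≤m))))

    tripleProduct-≗[]-thetaPartial : ∀ {M} m → M ℕ.+ M ℕ.≤ suc m →
                                     tripleProduct (suc m) ⊛ η∞ ≗[ M ] thetaPartial (suc m)
    tripleProduct-≗[]-thetaPartial {M} m 2M≤n =
      monomial-⊛-cancel-≗[] (s ℤ.^ suc m) (centreExponent m) (^-unit {s} s²≡1 (suc m))
      (begin
        centre m ⊛ (tripleProduct (suc m) ⊛ η∞)              ≈⟨ ≗⇒≗[] D (binomialExpansion m) ⟩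
        ∑ (λ j → termMonomial m j ⊛ (gaussian q M₂ j ⊛ η∞)) (suc M₂) ≈⟨ binomialExpansion-≗[] m 2M≤n ⟩
        ∑ (termMonomial m) (suc M₂)                            ≈⟨ ≗⇒≗[] D (termMonomials-centred m) ⟩
        centre m ⊛ thetaPartial (suc m)                        ∎)
      where
      D = centreExponent m ℕ.+ M
      M₂ = suc m ℕ.+ suc m
      open ≗[]-Reasoning D

  private
    thetaTerm-≗[]-zeroP : ∀ {M t} → M ℕ.< suc t → thetaTerm t ≗[ M ] zeroP
    thetaTerm-≗[]-zeroP {M} {t} M<st = agree λ n n≤M → cong₂ _+_
      (coeff (monomial-≗[]-zeroP (s ℤ.^ suc t) (ℕP.<-≤-trans M<st (e₊-≥ t))) n n≤M)
      (coeff (monomial-≗[]-zeroP (s ℤ.^ suc t) (ℕP.<-≤-trans M<st (e₋-≥ t))) n n≤M)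

    thetaPartial-stable : ∀ {M} K → M ℕ.< K → thetaPartial K ≗[ M ] thetaPartial (suc M)
    thetaPartial-stable {M} (suc K) (s≤s M≤K) with ℕP.m≤n⇒m<n∨m≡n M≤K
    ... | inj₂ refl = ≗[]-refl
    ... | inj₁ M<K  = begin
      oneP +ₚ (∑ thetaTerm K +ₚ thetaTerm K)
        ≈⟨ +ₚ-congˡ-≗[] oneP (+ₚ-congˡ-≗[] (∑ thetaTerm K) (thetaTerm-≗[]-zeroP (ℕP.m<n⇒m<1+n M<K))) ⟩
      oneP +ₚ (∑ thetaTerm K +ₚ zeroP)
        ≈⟨ ≗⇒≗[] M (+ₚ-congˡ oneP (+ₚ-identityʳ-≗ (∑ thetaTerm K) (λ _ → refl))) ⟩
      thetaPartial K                          ≈⟨ thetaPartial-stable K M<K ⟩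
      thetaPartial (suc M)                    ∎
      where open ≗[]-Reasoning M

  θ-≗[]-thetaPartial : ∀ {M} K → M ℕ.< K → θ ≗[ M ] thetaPartial K
  θ-≗[]-thetaPartial K M<K = agree λ n n≤M → sym (coeff (thetaPartial-stable K (ℕP.≤-<-trans n≤M M<K)) n ℕP.≤-refl)

  jacobi-triple-product : ∀ {M} m → M ℕ.+ M ℕ.≤ suc m → tripleProduct (suc m) ⊛ η∞ ≗[ M ] θ
  jacobi-triple-product {M} m 2M≤n =
    ≗[]-trans (tripleProduct-≗[]-thetaPartial m 2M≤n) (≗[]-sym (θ-≗[]-thetaPartial (suc m) (M<n M 2M≤n)))
    where
    M<n : ∀ M → M ℕ.+ M ℕ.≤ suc m → M ℕ.< suc m
    M<n zero     _    = s≤s z≤n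
    M<n (suc M′) 2M≤n = ℕP.<-≤-trans (s≤s (ℕP.m≤n+m (suc M′) M′)) 2M≤n

module _ (α β : ℕ) .{{_ : NonZero α}} .{{_ : NonZero β}} where
  open TripleProductExponents α β using (N; N-nonZero)

  -- Doubling the exponents inserts the factors 1 + x^m (m ∈ S), which assemble into the
  -- triple product with s = 1.
  residue-doubling : ∀ S → (∀ j k → S (j ℕ.+ k ℕ.* N) ≡ S j) →
    (∀ e → finProd S e N ≡ (oneP ⊛ factor (e α)) ⊛ factor (e β)) →
    let open JacobiTripleProduct α β (+ 1) refl in
    infProd S (2 ℕ.*_) ⊛ η∞ ≗ θ ⊛ infProd S (1 ℕ.*_)
  residue-doubling S S-periodic block = ≗[]⇒≗ up-to
    where
    open JacobiTripleProduct α β (+ 1) refl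
    blocks : ∀ c n → finProd S (c ℕ.*_) (n ℕ.* N)
                       ≗ ∏ (λ k → (oneP ⊛ factor (c ℕ.* (α ℕ.+ k ℕ.* N))) ⊛ factor (c ℕ.* (β ℕ.+ k ℕ.* N))) n
    blocks c n m = trans (finProd-periodic S (c ℕ.*_) N S-periodic n m)
                         (∏-cong n (λ k m → cong (λ z → z m) (block (λ j → c ℕ.* (j ℕ.+ k ℕ.* N)))) m)
    doubled-block : ∀ k → (oneP ⊛ factor (2 ℕ.* (α ℕ.+ k ℕ.* N))) ⊛ factor (2 ℕ.* (β ℕ.+ k ℕ.* N))
                          ≗ (upperFactor k ⊛ lowerFactor k) ⊛ ((oneP ⊛ factor (1 ℕ.* (α ℕ.+ k ℕ.* N))) ⊛ factor (1 ℕ.* (β ℕ.+ k ℕ.* N)))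
    doubled-block k = begin
      (oneP ⊛ factor (2 ℕ.* a)) ⊛ factor (2 ℕ.* b)
        ≈⟨ ⊛-cong (⊛-congˡ oneP (factor-double a)) (factor-double b) ⟨
      (oneP ⊛ ((oneP +ₚ x^ a) ⊛ factor (1 ℕ.* a))) ⊛ ((oneP +ₚ x^ b) ⊛ factor (1 ℕ.* b))
        ≈⟨ solve 5 (λ o U A L B → (o :* (U :* A)) :* (L :* B) := (U :* L) :* ((o :* A) :* B))
                  (λ _ → refl) oneP (oneP +ₚ x^ a) (factor (1 ℕ.* a)) (oneP +ₚ x^ b) (factor (1 ℕ.* b)) ⟩
      (upperFactor k ⊛ lowerFactor k) ⊛ ((oneP ⊛ factor (1 ℕ.* a)) ⊛ factor (1 ℕ.* b)) ∎
      where open ≗-Reasoning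
            a = α ℕ.+ k ℕ.* N
            b = β ℕ.+ k ℕ.* N
    doubled-blocks : ∀ n → finProd S (2 ℕ.*_) (n ℕ.* N) ≗ tripleProduct n ⊛ finProd S (1 ℕ.*_) (n ℕ.* N)
    doubled-blocks n m = trans (blocks 2 n m) (trans (∏-cong n doubled-block m)
      (trans (∏.homo (λ k → upperFactor k ⊛ lowerFactor k) _ n m)
             (⊛-cong (∏.homo upperFactor lowerFactor n) (λ m → sym (blocks 1 n m)) m)))
    up-to : ∀ d → infProd S (2 ℕ.*_) ⊛ η∞ ≗[ d ] θ ⊛ infProd S (1 ℕ.*_)
    up-to d = begin
      infProd S (2 ℕ.*_) ⊛ η∞
        ≈⟨ ⊛-congʳ-≗[] η∞ (infProd-≗[]-finProd S (2 ℕ.*_) (k≤c*k 2) (n ℕ.* N) (d≤[1+2d]*c N d)) ⟩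
      finProd S (2 ℕ.*_) (n ℕ.* N) ⊛ η∞
        ≈⟨ ≗⇒≗[] d (⊛-congʳ η∞ (doubled-blocks n)) ⟩
      (tripleProduct n ⊛ finProd S (1 ℕ.*_) (n ℕ.* N)) ⊛ η∞
        ≈⟨ ⊛-congʳ-≗[] η∞ (⊛-congˡ-≗[] (tripleProduct n)
             (≗[]-sym (infProd-≗[]-finProd S (1 ℕ.*_) (k≤c*k 1) (n ℕ.* N) (d≤[1+2d]*c N d)))) ⟩
      (tripleProduct n ⊛ infProd S (1 ℕ.*_)) ⊛ η∞
        ≈⟨ ≗⇒≗[] d (⊛.xy∙z≈xz∙y (tripleProduct n) (infProd S (1 ℕ.*_)) η∞) ⟩
      (tripleProduct n ⊛ η∞) ⊛ infProd S (1 ℕ.*_)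
        ≈⟨ ⊛-congʳ-≗[] (infProd S (1 ℕ.*_)) (jacobi-triple-product (d ℕ.+ d) (ℕP.n≤1+n (d ℕ.+ d))) ⟩
      θ ⊛ infProd S (1 ℕ.*_) ∎
      where
      open ≗[]-Reasoning d
      n = suc (d ℕ.+ d)

-- The eta products of the theorem, without their leading powers of q

eulerProduct : ℕ → PS
eulerProduct c = infProd (λ _ → true) (λ m → c ℕ.* m)

±mod12 : ℕ → ℕ → Bool
±mod12 g m = ((m ℕ.% 12) ≡ᵇ g) ∨ ((m ℕ.% 12) ≡ᵇ (12 ∸ g))

residueProduct : ℕ → ℕ → PS
residueProduct g c = infProd (±mod12 g) (λ m → c ℕ.* m)

±mod12-reduce : ∀ g m → ±mod12 g (m ℕ.% 12) ≡ ±mod12 g m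
±mod12-reduce g m = cong (λ r → (r ≡ᵇ g) ∨ (r ≡ᵇ (12 ∸ g))) (DM.m%n%n≡m%n m 12)

±mod12-periodic : ∀ g j k → ±mod12 g (j ℕ.+ k ℕ.* 12) ≡ ±mod12 g j
±mod12-periodic g j k = cong (λ r → (r ≡ᵇ g) ∨ (r ≡ᵇ (12 ∸ g))) (DM.[m+kn]%n≡m%n j k 12)

-- Both sides are ∏ (1 - x^d)^(μ d) with the same 24-periodic multiplicities μ.
eulerProduct-residueProduct : ((eulerProduct 4 ⊛ eulerProduct 6) ⊛ residueProduct 1 2) ⊛ residueProduct 5 2
                                ≗ eulerProduct 2 ⊛ eulerProduct 12
eulerProduct-residueProduct = begin
  ((eulerProduct 4 ⊛ eulerProduct 6) ⊛ residueProduct 1 2) ⊛ residueProduct 5 2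
    ≈⟨ ⊛-cong (⊛-cong (⊛-cong (infProd-multiplicityProduct all 3) (infProd-multiplicityProduct all 5))
                       (infProd-multiplicityProduct (±mod12 1) 1))
              (infProd-multiplicityProduct (±mod12 5) 1) ⟩
  ((Π (multiplicity all 4) ⊛ Π (multiplicity all 6)) ⊛ Π (multiplicity (±mod12 1) 2)) ⊛ Π (multiplicity (±mod12 5) 2)
    ≈⟨ ⊛-congʳ (Π (multiplicity (±mod12 5) 2)) (⊛-congʳ (Π (multiplicity (±mod12 1) 2))
         (multiplicityProduct-+ (multiplicity all 4) (multiplicity all 6))) ⟨
  (Π μ₂ ⊛ Π (multiplicity (±mod12 1) 2)) ⊛ Π (multiplicity (±mod12 5) 2)
    ≈⟨ ⊛-congʳ (Π (multiplicity (±mod12 5) 2)) (multiplicityProduct-+ μ₂ (multiplicity (±mod12 1) 2)) ⟨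
  Π μ₃ ⊛ Π (multiplicity (±mod12 5) 2)
    ≈⟨ multiplicityProduct-+ μ₃ (multiplicity (±mod12 5) 2) ⟨
  Π μ
    ≈⟨ multiplicityProduct-cong {μ} {ν} (λ d → agree-mod μ ν 24 μ-periodic ν-periodic
         (toWitness {a? = FinP.all? (λ r → μ (Fin.toℕ r) ℕ.≟ ν (Fin.toℕ r))} _) (suc d)) ⟩
  Π ν
    ≈⟨ multiplicityProduct-+ (multiplicity all 2) (multiplicity all 12) ⟩
  Π (multiplicity all 2) ⊛ Π (multiplicity all 12)
    ≈⟨ ⊛-cong (infProd-multiplicityProduct all 1) (infProd-multiplicityProduct all 11) ⟨
  eulerProduct 2 ⊛ eulerProduct 12 ∎
  where
  open ≗-Reasoning
  Π = multiplicityProduct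
  all : ℕ → Bool
  all _ = true
  μ₂ μ₃ μ ν : ℕ → ℕ
  μ₂ d = multiplicity all 4 d ℕ.+ multiplicity all 6 d
  μ₃ d = μ₂ d ℕ.+ multiplicity (±mod12 1) 2 d
  μ d = μ₃ d ℕ.+ multiplicity (±mod12 5) 2 d
  ν d = multiplicity all 2 d ℕ.+ multiplicity all 12 d
  μ-periodic : ∀ d → μ d ≡ μ (d ℕ.% 24)
  μ-periodic d rewrite multiplicity-mod all 4 6 (λ _ → refl) d | multiplicity-mod all 6 4 (λ _ → refl) d
                     | multiplicity-mod (±mod12 1) 2 12 (±mod12-reduce 1) d
                     | multiplicity-mod (±mod12 5) 2 12 (±mod12-reduce 5) d = refl
  ν-periodic : ∀ d → ν d ≡ ν (d ℕ.% 24)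
  ν-periodic d rewrite multiplicity-mod all 2 12 (λ _ → refl) d | multiplicity-mod all 12 2 (λ _ → refl) d = refl

module Euler = JacobiTripleProduct 1 2 -[1+ 0 ] refl

-- Euler's pentagonal number theorem: the residues mod 3 split (x; x)_∞ into a triple product.
euler-pentagonal : eulerProduct 1 ≗ Euler.θ
euler-pentagonal = ≗[]⇒≗ up-to
  where
  block : ∀ k → ((oneP ⊛ factor (1 ℕ.* (1 ℕ.+ k ℕ.* 3))) ⊛ factor (1 ℕ.* (2 ℕ.+ k ℕ.* 3))) ⊛ factor (1 ℕ.* (3 ℕ.+ k ℕ.* 3))
                ≗ (Euler.upperFactor k ⊛ Euler.lowerFactor k) ⊛ factor (3 ℕ.* suc k)
  block k = begin
    ((oneP ⊛ factor (1 ℕ.* (1 ℕ.+ k ℕ.* 3))) ⊛ factor (1 ℕ.* (2 ℕ.+ k ℕ.* 3))) ⊛ factor (1 ℕ.* (3 ℕ.+ k ℕ.* 3))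
      ≈⟨ ⊛-cong (⊛-cong (⊛-congˡ oneP (factor-1* (1 ℕ.+ k ℕ.* 3))) (factor-1* (2 ℕ.+ k ℕ.* 3)))
                 (λ m → cong (λ e → factor e m) (index k)) ⟩
    ((oneP ⊛ Euler.upperFactor k) ⊛ Euler.lowerFactor k) ⊛ factor (3 ℕ.* suc k)
      ≈⟨ ⊛-congʳ (factor (3 ℕ.* suc k)) (⊛-congʳ (Euler.lowerFactor k) (⊛-identityˡ (Euler.upperFactor k))) ⟩
    (Euler.upperFactor k ⊛ Euler.lowerFactor k) ⊛ factor (3 ℕ.* suc k) ∎
    where
    open ≗-Reasoning
    index : ∀ k → 1 ℕ.* (3 ℕ.+ k ℕ.* 3) ≡ 3 ℕ.* suc k
    index = ℕ-Solver.solve-∀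
  blocks : ∀ n → finProd (λ _ → true) (1 ℕ.*_) (n ℕ.* 3) ≗ Euler.tripleProduct n ⊛ finProd (λ _ → true) (3 ℕ.*_) n
  blocks n m = trans (finProd-periodic (λ _ → true) (1 ℕ.*_) 3 (λ _ _ → refl) n m)
    (trans (∏-cong n block m)
    (trans (∏.homo (λ k → Euler.upperFactor k ⊛ Euler.lowerFactor k) (λ k → factor (3 ℕ.* suc k)) n m)
           (⊛-cong (∏.homo Euler.upperFactor Euler.lowerFactor n) (λ m → sym (finProd-all (3 ℕ.*_) n m)) m)))
  up-to : ∀ d → eulerProduct 1 ≗[ d ] Euler.θ
  up-to d = begin
    eulerProduct 1
      ≈⟨ infProd-≗[]-finProd (λ _ → true) (1 ℕ.*_) (k≤c*k 1) (n ℕ.* 3) (d≤[1+2d]*c 3 d) ⟩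
    finProd (λ _ → true) (1 ℕ.*_) (n ℕ.* 3)
      ≈⟨ ≗⇒≗[] d (blocks n) ⟩
    Euler.tripleProduct n ⊛ finProd (λ _ → true) (3 ℕ.*_) n
      ≈⟨ ⊛-congˡ-≗[] (Euler.tripleProduct n) (≗[]-sym (infProd-≗[]-finProd (λ _ → true) (3 ℕ.*_) (k≤c*k 3) n
           (ℕP.≤-trans (ℕP.m≤m+n d d) (ℕP.n≤1+n _)))) ⟩
    Euler.tripleProduct n ⊛ Euler.η∞
      ≈⟨ Euler.jacobi-triple-product (d ℕ.+ d) (ℕP.n≤1+n (d ℕ.+ d)) ⟩
    Euler.θ ∎
    where
    open ≗[]-Reasoning d
    n = suc (d ℕ.+ d)

module Residue5 = JacobiTripleProduct 5 7 (+ 1) refl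
module Residue1 = JacobiTripleProduct 1 11 (+ 1) refl

private
  module EulerExp = TripleProductExponents 1 2
  module Residue5Exp = TripleProductExponents 5 7
  module Residue1Exp = TripleProductExponents 1 11

  -- The pentagonal exponents t(3t ∓ 1)/2 at t = 2K + 1.
  oddExponent₊ oddExponent₋ : ℕ → ℕ
  oddExponent₊ K = 12 ℕ.* triangular K ℕ.+ 11 ℕ.* K ℕ.+ 1
  oddExponent₋ K = 12 ℕ.* triangular K ℕ.+ 13 ℕ.* K ℕ.+ 2

  triangular-twice : ∀ K → triangular (K ℕ.+ K) ≡ 4 ℕ.* triangular K ℕ.+ K
  triangular-twice K = trans (triangular-+ K K)
    (trans (cong (λ z → triangular K ℕ.+ triangular K ℕ.+ z) (sym (square K))) (regroup (triangular K) K))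
    where
    square : ∀ K → triangular K ℕ.+ triangular K ℕ.+ K ≡ K ℕ.* K
    square zero    = refl
    square (suc t) = trans (cong (ℕ._+ suc t) (triangular-double t)) (expand t)
      where expand : ∀ t → suc t ℕ.* t ℕ.+ suc t ≡ suc t ℕ.* suc t
            expand = ℕ-Solver.solve-∀
    regroup : ∀ x K → x ℕ.+ x ℕ.+ (x ℕ.+ x ℕ.+ K) ≡ 4 ℕ.* x ℕ.+ K
    regroup = ℕ-Solver.solve-∀

  odd₊ : ∀ K → EulerExp.e₊ (suc (K ℕ.+ K)) ≡ oddExponent₊ K
  odd₊ K = trans (cong (λ z → 1 ℕ.* suc (K ℕ.+ K) ℕ.+ (z ℕ.+ (K ℕ.+ K)) ℕ.* 3) (triangular-twice K)) (expand (triangular K) K)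
    where expand : ∀ x K → 1 ℕ.* suc (K ℕ.+ K) ℕ.+ (4 ℕ.* x ℕ.+ K ℕ.+ (K ℕ.+ K)) ℕ.* 3 ≡ 12 ℕ.* x ℕ.+ 11 ℕ.* K ℕ.+ 1
          expand = ℕ-Solver.solve-∀

  odd₋ : ∀ K → EulerExp.e₋ (suc (K ℕ.+ K)) ≡ oddExponent₋ K
  odd₋ K = trans (cong (λ z → 2 ℕ.* suc (K ℕ.+ K) ℕ.+ (z ℕ.+ (K ℕ.+ K)) ℕ.* 3) (triangular-twice K)) (expand (triangular K) K)
    where expand : ∀ x K → 2 ℕ.* suc (K ℕ.+ K) ℕ.+ (4 ℕ.* x ℕ.+ K ℕ.+ (K ℕ.+ K)) ℕ.* 3 ≡ 12 ℕ.* x ℕ.+ 13 ℕ.* K ℕ.+ 2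
          expand = ℕ-Solver.solve-∀

  even₊ : ∀ K → EulerExp.e₊ (suc K ℕ.+ suc K) ≡ Residue5Exp.e₊ (suc K)
  even₊ K = trans (cong (λ z → 1 ℕ.* (suc K ℕ.+ suc K) ℕ.+ z ℕ.* 3) (triangular-twice (suc K))) (expand (triangular (suc K)) (suc K))
    where expand : ∀ x S → 1 ℕ.* (S ℕ.+ S) ℕ.+ (4 ℕ.* x ℕ.+ S) ℕ.* 3 ≡ 5 ℕ.* S ℕ.+ x ℕ.* 12
          expand = ℕ-Solver.solve-∀

  even₋ : ∀ K → EulerExp.e₋ (suc K ℕ.+ suc K) ≡ Residue5Exp.e₋ (suc K)
  even₋ K = trans (cong (λ z → 2 ℕ.* (suc K ℕ.+ suc K) ℕ.+ z ℕ.* 3) (triangular-twice (suc K))) (expand (triangular (suc K)) (suc K))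
    where expand : ∀ x S → 2 ℕ.* (S ℕ.+ S) ℕ.+ (4 ℕ.* x ℕ.+ S) ℕ.* 3 ≡ 7 ℕ.* S ℕ.+ x ℕ.* 12
          expand = ℕ-Solver.solve-∀

  shifted₊ : ∀ K → suc (Residue1Exp.e₊ (suc K)) ≡ oddExponent₋ K
  shifted₊ K = expand (triangular K) K
    where expand : ∀ x K → suc (1 ℕ.* suc K ℕ.+ (x ℕ.+ K) ℕ.* 12) ≡ 12 ℕ.* x ℕ.+ 13 ℕ.* K ℕ.+ 2
          expand = ℕ-Solver.solve-∀

  shifted₋ : ∀ K → suc (Residue1Exp.e₋ (suc K)) ≡ oddExponent₊ (suc K)
  shifted₋ K = expand (triangular K) K
    where expand : ∀ x K → suc (11 ℕ.* suc K ℕ.+ (x ℕ.+ K) ℕ.* 12) ≡ 12 ℕ.* (x ℕ.+ K) ℕ.+ 11 ℕ.* suc K ℕ.+ 1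
          expand = ℕ-Solver.solve-∀

  -1^odd : ∀ K → -[1+ 0 ] ℤ.^ suc (K ℕ.+ K) ≡ -[1+ 0 ]
  -1^even : ∀ K → -[1+ 0 ] ℤ.^ (K ℕ.+ K) ≡ + 1
  -1^odd K rewrite -1^even K = refl
  -1^even zero    = refl
  -1^even (suc K) rewrite ℕP.+-suc K K | -1^odd K = refl

  x¹ : PS
  x¹ = x^ 1

  x¹-⊛-monomial : ∀ c k → x¹ ⊛ monomial c k ≗ monomial c (suc k)
  x¹-⊛-monomial c k n = trans (monomial-⊛-monomial (+ 1) 1 c k n) (monomial-cong {j = suc k} (ℤP.*-identityˡ c) refl n)

-- Splitting Σ (-1)^t x^(t(3t-1)/2) by the parity of t; the leftover term has degree above K.
pentagonal-dissection-partial : ∀ K →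
  Euler.thetaPartial (K ℕ.+ K) +ₚ x¹ ⊛ Residue1.thetaPartial K ≗ Residue5.thetaPartial K +ₚ x^ (oddExponent₊ K)
pentagonal-dissection-partial zero    = λ n → cong (λ z → oneP n + + 0 + z)
  (trans (⊛-distribˡ x¹ oneP zeroP n) (trans (cong₂ _+_ (trans (⊛-identityʳ x¹ n) refl) (⊛-vanishʳ x¹ zeroP (λ _ → refl) n))
         (ℤP.+-identityʳ _)))
pentagonal-dissection-partial (suc K) = begin
  Euler.thetaPartial (suc K ℕ.+ suc K) +ₚ x¹ ⊛ Residue1.thetaPartial (suc K)
    ≡⟨ cong (λ z → Euler.thetaPartial z +ₚ x¹ ⊛ Residue1.thetaPartial (suc K)) (ℕP.+-suc (suc K) K) ⟩
  (oneP +ₚ (∑ Euler.thetaTerm (K ℕ.+ K) +ₚ odd +ₚ even)) +ₚ x¹ ⊛ (oneP +ₚ (∑ Residue1.thetaTerm K +ₚ Residue1.thetaTerm K))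
    ≈⟨ solve 7 (λ o s a b p S r → (o :+ (s :+ a :+ b)) :+ p :* (o :+ (S :+ r)) := (o :+ s :+ p :* (o :+ S)) :+ (a :+ b :+ p :* r))
             (λ _ → refl) oneP (∑ Euler.thetaTerm (K ℕ.+ K)) odd even x¹ (∑ Residue1.thetaTerm K) (Residue1.thetaTerm K) ⟩
  (Euler.thetaPartial (K ℕ.+ K) +ₚ x¹ ⊛ Residue1.thetaPartial K) +ₚ (odd +ₚ even +ₚ x¹ ⊛ Residue1.thetaTerm K)
    ≈⟨ +ₚ-cong (pentagonal-dissection-partial K) (+ₚ-cong (+ₚ-cong odd-term even-term) shifted-term) ⟩
  (Residue5.thetaPartial K +ₚ E K) +ₚ ((-ₚ E K +ₚ -ₚ O K) +ₚ Residue5.thetaTerm K +ₚ (O K +ₚ E (suc K)))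
    ≈⟨ solve 6 (λ u a e o t f → (u :+ a :+ e) :+ ((:- e :+ :- o) :+ t :+ (o :+ f)) := (u :+ (a :+ t)) :+ f)
             (λ _ → refl) oneP (∑ Residue5.thetaTerm K) (E K) (O K) (Residue5.thetaTerm K) (E (suc K)) ⟩
  Residue5.thetaPartial (suc K) +ₚ E (suc K) ∎
  where
  open ≗-Reasoning
  E O : ℕ → PS
  E K = x^ (oddExponent₊ K)
  O K = x^ (oddExponent₋ K)
  odd = Euler.thetaTerm (K ℕ.+ K)
  even = Euler.thetaTerm (suc (K ℕ.+ K))
  odd-term : odd ≗ -ₚ E K +ₚ -ₚ O K
  odd-term = +ₚ-cong (λ n → trans (cong₂ (λ c k → monomial c k n) (-1^odd K) (odd₊ K)) (monomial-neg (+ 1) (oddExponent₊ K) n))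
                     (λ n → trans (cong₂ (λ c k → monomial c k n) (-1^odd K) (odd₋ K)) (monomial-neg (+ 1) (oddExponent₋ K) n))
  even-sign : -[1+ 0 ] ℤ.^ suc (suc (K ℕ.+ K)) ≡ (+ 1) ℤ.^ suc K
  even-sign = trans (cong (-[1+ 0 ] ℤ.^_) (sym (ℕP.+-suc (suc K) K))) (trans (-1^even (suc K)) (sym (ℤP.^-zeroˡ (suc K))))
  even-term : even ≗ Residue5.thetaTerm K
  even-term = +ₚ-cong (monomial-cong even-sign (trans (cong EulerExp.e₊ (sym (ℕP.+-suc (suc K) K))) (even₊ K)))
                      (monomial-cong even-sign (trans (cong EulerExp.e₋ (sym (ℕP.+-suc (suc K) K))) (even₋ K)))
  shifted-term : x¹ ⊛ Residue1.thetaTerm K ≗ O K +ₚ E (suc K)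
  shifted-term = begin
    x¹ ⊛ Residue1.thetaTerm K
      ≈⟨ ⊛-distribˡ x¹ (monomial ((+ 1) ℤ.^ suc K) (Residue1Exp.e₊ (suc K))) (monomial ((+ 1) ℤ.^ suc K) (Residue1Exp.e₋ (suc K))) ⟩
    x¹ ⊛ monomial ((+ 1) ℤ.^ suc K) (Residue1Exp.e₊ (suc K)) +ₚ x¹ ⊛ monomial ((+ 1) ℤ.^ suc K) (Residue1Exp.e₋ (suc K))
      ≈⟨ +ₚ-cong (x¹-⊛-monomial _ (Residue1Exp.e₊ (suc K))) (x¹-⊛-monomial _ (Residue1Exp.e₋ (suc K))) ⟩
    monomial ((+ 1) ℤ.^ suc K) (suc (Residue1Exp.e₊ (suc K))) +ₚ monomial ((+ 1) ℤ.^ suc K) (suc (Residue1Exp.e₋ (suc K)))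
      ≈⟨ +ₚ-cong (monomial-cong (ℤP.^-zeroˡ (suc K)) (shifted₊ K)) (monomial-cong (ℤP.^-zeroˡ (suc K)) (shifted₋ K)) ⟩
    O K +ₚ E (suc K) ∎

pentagonal-dissection : Euler.θ +ₚ x¹ ⊛ Residue1.θ ≗ Residue5.θ
pentagonal-dissection n = begin
  Euler.θ n + (x¹ ⊛ Residue1.θ) n
    ≡⟨ cong₂ _+_ (coeff (Euler.θ-≗[]-thetaPartial (K ℕ.+ K) (ℕP.<-≤-trans (ℕP.n<1+n n) (ℕP.m≤m+n K K))) n ℕP.≤-refl)
                 (coeff (monomial-⊛-cong-≗[] (+ 1) 1 (Residue1.θ-≗[]-thetaPartial K (ℕP.n<1+n n))) n (ℕP.n≤1+n n)) ⟩
  Euler.thetaPartial (K ℕ.+ K) n + (x¹ ⊛ Residue1.thetaPartial K) n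
    ≡⟨ pentagonal-dissection-partial K n ⟩
  Residue5.thetaPartial K n + (x^ (oddExponent₊ K)) n
    ≡⟨ cong (λ z → Residue5.thetaPartial K n + z) (monomial-< (+ 1) n<E) ⟩
  Residue5.thetaPartial K n + + 0
    ≡⟨ ℤP.+-identityʳ _ ⟩
  Residue5.thetaPartial K n
    ≡⟨ coeff (Residue5.θ-≗[]-thetaPartial K (ℕP.n<1+n n)) n ℕP.≤-refl ⟨
  Residue5.θ n ∎
  where
  open ≡-Reasoning
  K = suc n
  n<E : n ℕ.< oddExponent₊ K
  n<E = ℕP.≤-trans (ℕP.m≤n*m K 11) (ℕP.≤-trans (ℕP.m≤n+m (11 ℕ.* K) (12 ℕ.* triangular K)) (ℕP.m≤m+n _ 1))

residue5-doubling : residueProduct 5 2 ⊛ eulerProduct 12 ≗ Residue5.θ ⊛ residueProduct 5 1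
residue5-doubling = residue-doubling 5 7 (±mod12 5) (±mod12-periodic 5) (λ _ → refl)

residue1-doubling : residueProduct 1 2 ⊛ eulerProduct 12 ≗ Residue1.θ ⊛ residueProduct 1 1
residue1-doubling = residue-doubling 1 11 (±mod12 1) (±mod12-periodic 1) (λ _ → refl)

-- E₁ P₁ P₅ + q P₁(q²) P₅ E₁₂ = P₅(q²) P₁ E₁₂, in the notation of the header (x = q here).
product-identity : (eulerProduct 1 ⊛ residueProduct 1 1) ⊛ residueProduct 5 1
                   +ₚ x¹ ⊛ ((residueProduct 1 2 ⊛ eulerProduct 12) ⊛ residueProduct 5 1)
                 ≗ (residueProduct 5 2 ⊛ eulerProduct 12) ⊛ residueProduct 1 1
product-identity = begin
  (eulerProduct 1 ⊛ P₁) ⊛ P₅ +ₚ x¹ ⊛ ((residueProduct 1 2 ⊛ eulerProduct 12) ⊛ P₅)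
    ≈⟨ +ₚ-cong (⊛-congʳ P₅ (⊛-congʳ P₁ euler-pentagonal)) (⊛-congˡ x¹ (⊛-congʳ P₅ residue1-doubling)) ⟩
  (Euler.θ ⊛ P₁) ⊛ P₅ +ₚ x¹ ⊛ ((Residue1.θ ⊛ P₁) ⊛ P₅)
    ≈⟨ solve 5 (λ t₃ t₁ a b q → (t₃ :* a) :* b :+ q :* ((t₁ :* a) :* b) := ((t₃ :+ q :* t₁) :* b) :* a)
             (λ _ → refl) Euler.θ Residue1.θ P₁ P₅ x¹ ⟩
  ((Euler.θ +ₚ x¹ ⊛ Residue1.θ) ⊛ P₅) ⊛ P₁
    ≈⟨ ⊛-congʳ P₁ (⊛-congʳ P₅ pentagonal-dissection) ⟩
  (Residue5.θ ⊛ P₅) ⊛ P₁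
    ≈⟨ ⊛-congʳ P₁ residue5-doubling ⟨
  (residueProduct 5 2 ⊛ eulerProduct 12) ⊛ P₁ ∎
  where
  open ≗-Reasoning
  P₁ = residueProduct 1 1
  P₅ = residueProduct 5 1

-- The leading powers of G(2) H(1) and G(1) H(2) differ by exactly q, whence the factor x¹.
G₂H₁-G₁H₂ : PS
G₂H₁-G₁H₂ = invPS (residueProduct 1 2) ⊛ invPS (residueProduct 5 1)
         +ₚ -ₚ (x¹ ⊛ (invPS (residueProduct 1 1) ⊛ invPS (residueProduct 5 2)))

etaQuotient : PS
etaQuotient = (((eulerProduct 1 ⊛ eulerProduct 4) ⊛ eulerProduct 6) ⊛ invPS (eulerProduct 2))
            ⊛ invPS (eulerProduct 12 ⊛ eulerProduct 12)

clearing cleared : PS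
clearing = ((residueProduct 1 2 ⊛ residueProduct 5 1) ⊛ residueProduct 1 1) ⊛ residueProduct 5 2
cleared = residueProduct 1 1 ⊛ residueProduct 5 2 +ₚ -ₚ (x¹ ⊛ (residueProduct 1 2 ⊛ residueProduct 5 1))

G₂H₁-G₁H₂-cleared : G₂H₁-G₁H₂ ⊛ clearing ≗ cleared
G₂H₁-G₁H₂-cleared = begin
  (invPS a₂ ⊛ invPS b +ₚ -ₚ (x¹ ⊛ (invPS a ⊛ invPS b₂))) ⊛ clearing
    ≈⟨ solve 9 (λ ia₂ ib ia ib₂ a a₂ b b₂ q → ((ia₂ :* ib) :+ :- (q :* (ia :* ib₂))) :* (((a₂ :* b) :* a) :* b₂)
                 := ((ia₂ :* a₂) :* (ib :* b)) :* (a :* b₂) :+ :- (q :* (((ia :* a) :* (ib₂ :* b₂)) :* (a₂ :* b))))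
             (λ _ → refl) (invPS a₂) (invPS b) (invPS a) (invPS b₂) a a₂ b b₂ x¹ ⟩
  ((invPS a₂ ⊛ a₂) ⊛ (invPS b ⊛ b)) ⊛ (a ⊛ b₂) +ₚ -ₚ (x¹ ⊛ (((invPS a ⊛ a) ⊛ (invPS b₂ ⊛ b₂)) ⊛ (a₂ ⊛ b)))
    ≈⟨ +ₚ-cong (⊛-congʳ (a ⊛ b₂) (⊛-cong (invPS-inverseˡ a₂ refl) (invPS-inverseˡ b refl)))
               (λ n → cong -_ (⊛-congˡ x¹ (⊛-congʳ (a₂ ⊛ b) (⊛-cong (invPS-inverseˡ a refl) (invPS-inverseˡ b₂ refl))) n)) ⟩
  (oneP ⊛ oneP) ⊛ (a ⊛ b₂) +ₚ -ₚ (x¹ ⊛ ((oneP ⊛ oneP) ⊛ (a₂ ⊛ b)))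
    ≈⟨ solve 4 (λ a b₂ q c → (con (+ 1) :* con (+ 1)) :* (a :* b₂) :+ :- (q :* ((con (+ 1) :* con (+ 1)) :* c)) := a :* b₂ :+ :- (q :* c))
             (λ _ → refl) a b₂ x¹ (a₂ ⊛ b) ⟩
  cleared ∎
  where
  open ≗-Reasoning
  a = residueProduct 1 1
  a₂ = residueProduct 1 2
  b = residueProduct 5 1
  b₂ = residueProduct 5 2

etaQuotient-cleared : etaQuotient ⊛ clearing ≗ cleared
etaQuotient-cleared = begin
  ((((E₁ ⊛ E₄) ⊛ E₆) ⊛ invPS E₂) ⊛ invPS (E₁₂ ⊛ E₁₂)) ⊛ clearing
    ≈⟨ solve 9 (λ e₁ e₄ e₆ ie₂ ie a a₂ b b₂ → ((((e₁ :* e₄) :* e₆) :* ie₂) :* ie) :* (((a₂ :* b) :* a) :* b₂)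
                 := ((e₁ :* a) :* b) :* ((((e₄ :* e₆) :* a₂) :* b₂) :* (ie₂ :* ie)))
             (λ _ → refl) E₁ E₄ E₆ (invPS E₂) (invPS (E₁₂ ⊛ E₁₂)) a a₂ b b₂ ⟩
  ((E₁ ⊛ a) ⊛ b) ⊛ ((((E₄ ⊛ E₆) ⊛ a₂) ⊛ b₂) ⊛ (invPS E₂ ⊛ invPS (E₁₂ ⊛ E₁₂)))
    ≈⟨ ⊛-congˡ ((E₁ ⊛ a) ⊛ b) (⊛-cong eulerProduct-residueProduct (⊛-congˡ (invPS E₂) (invPS-⊛ E₁₂ E₁₂ refl refl))) ⟩
  ((E₁ ⊛ a) ⊛ b) ⊛ ((E₂ ⊛ E₁₂) ⊛ (invPS E₂ ⊛ (invPS E₁₂ ⊛ invPS E₁₂)))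
    ≈⟨ ⊛-congˡ ((E₁ ⊛ a) ⊛ b) (solve 4 (λ e₂ e ie₂ ie → (e₂ :* e) :* (ie₂ :* (ie :* ie)) := ((e₂ :* ie₂) :* (e :* ie)) :* ie)
                                      (λ _ → refl) E₂ E₁₂ (invPS E₂) (invPS E₁₂)) ⟩
  ((E₁ ⊛ a) ⊛ b) ⊛ (((E₂ ⊛ invPS E₂) ⊛ (E₁₂ ⊛ invPS E₁₂)) ⊛ invPS E₁₂)
    ≈⟨ ⊛-congˡ ((E₁ ⊛ a) ⊛ b) (⊛-congʳ (invPS E₁₂) (⊛-cong (invPS-inverseʳ E₂ refl) (invPS-inverseʳ E₁₂ refl))) ⟩
  ((E₁ ⊛ a) ⊛ b) ⊛ ((oneP ⊛ oneP) ⊛ invPS E₁₂)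
    ≈⟨ ⊛-cong solved-for-E₁ (solve 1 (λ ie → (con (+ 1) :* con (+ 1)) :* ie := ie) (λ _ → refl) (invPS E₁₂)) ⟩
  ((b₂ ⊛ E₁₂) ⊛ a +ₚ -ₚ (x¹ ⊛ ((a₂ ⊛ E₁₂) ⊛ b))) ⊛ invPS E₁₂
    ≈⟨ solve 7 (λ b₂ e a q a₂ b ie → ((b₂ :* e) :* a :+ :- (q :* ((a₂ :* e) :* b))) :* ie
                 := (e :* ie) :* (a :* b₂) :+ :- (q :* ((e :* ie) :* (a₂ :* b))))
             (λ _ → refl) b₂ E₁₂ a x¹ a₂ b (invPS E₁₂) ⟩
  (E₁₂ ⊛ invPS E₁₂) ⊛ (a ⊛ b₂) +ₚ -ₚ (x¹ ⊛ ((E₁₂ ⊛ invPS E₁₂) ⊛ (a₂ ⊛ b)))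
    ≈⟨ +ₚ-cong (⊛-congʳ (a ⊛ b₂) (invPS-inverseʳ E₁₂ refl))
               (λ n → cong -_ (⊛-congˡ x¹ (⊛-congʳ (a₂ ⊛ b) (invPS-inverseʳ E₁₂ refl)) n)) ⟩
  oneP ⊛ (a ⊛ b₂) +ₚ -ₚ (x¹ ⊛ (oneP ⊛ (a₂ ⊛ b)))
    ≈⟨ solve 4 (λ a b₂ q c → con (+ 1) :* (a :* b₂) :+ :- (q :* (con (+ 1) :* c)) := a :* b₂ :+ :- (q :* c))
             (λ _ → refl) a b₂ x¹ (a₂ ⊛ b) ⟩
  cleared ∎
  where
  open ≗-Reasoning
  a = residueProduct 1 1
  a₂ = residueProduct 1 2
  b = residueProduct 5 1
  b₂ = residueProduct 5 2
  E₁ = eulerProduct 1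
  E₂ = eulerProduct 2
  E₄ = eulerProduct 4
  E₆ = eulerProduct 6
  E₁₂ = eulerProduct 12
  solved-for-E₁ : (E₁ ⊛ a) ⊛ b ≗ (b₂ ⊛ E₁₂) ⊛ a +ₚ -ₚ (x¹ ⊛ ((a₂ ⊛ E₁₂) ⊛ b))
  solved-for-E₁ = +ₚ-moveʳ ((E₁ ⊛ a) ⊛ b) (x¹ ⊛ ((a₂ ⊛ E₁₂) ⊛ b)) product-identity

quotient-identity : G₂H₁-G₁H₂ ≗ etaQuotient
quotient-identity = ⊛-cancelʳ clearing refl (≗-trans G₂H₁-G₁H₂-cleared (≗-sym etaQuotient-cleared))

-- Substituting x ↦ x^D

module Spread (D : ℕ) .{{D≢0 : NonZero D}} where

  private
    ≢0⇒≡ᵇ-false : ∀ {r} → r ≢ 0 → (r ≡ᵇ 0) ≡ false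
    ≢0⇒≡ᵇ-false {zero}  r≢0 = ⊥-elim (r≢0 refl)
    ≢0⇒≡ᵇ-false {suc r} _   = refl

    divisible⇒multiple : ∀ n → n ℕ.% D ≡ 0 → n ≡ n ℕ./ D ℕ.* D
    divisible⇒multiple n n%D≡0 = trans (DM.m≡m%n+[m/n]*n n D) (cong (ℕ._+ n ℕ./ D ℕ.* D) n%D≡0)

  spread-off : ∀ a {n} → n ℕ.% D ≢ 0 → spread D a n ≡ + 0
  spread-off a {n} n%D≢0 rewrite ≢0⇒≡ᵇ-false n%D≢0 = refl

  spread-multiple : ∀ a j → spread D a (j ℕ.* D) ≡ a j
  spread-multiple a j rewrite DM.m*n%n≡0 j D {{D≢0}} | DM.m*n/n≡m j D {{D≢0}} = refl

  private
    sumTo-block : ∀ (f : ℕ → ℤ) m → (∀ k → k ℕ.% D ≢ 0 → f k ≡ + 0) → ∀ i → i ℕ.< D →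
      sumTo f (m ℕ.* D ℕ.+ i) ≡ sumTo f (m ℕ.* D)
    sumTo-block f m f-off zero    _     = cong (sumTo f) (ℕP.+-identityʳ (m ℕ.* D))
    sumTo-block f m f-off (suc i) 1+i<D = begin
      sumTo f (m ℕ.* D ℕ.+ suc i)                        ≡⟨ cong (sumTo f) (ℕP.+-suc (m ℕ.* D) i) ⟩
      sumTo f (m ℕ.* D ℕ.+ i) + f (suc (m ℕ.* D ℕ.+ i))
        ≡⟨ cong₂ _+_ (sumTo-block f m f-off i (ℕP.<-trans (ℕP.n<1+n i) 1+i<D))
                                                                         (f-off _ (λ r≡0 → ℕP.1+n≢0 (trans (sym remainder) r≡0))) ⟩
      sumTo f (m ℕ.* D) + + 0                            ≡⟨ ℤP.+-identityʳ _ ⟩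
      sumTo f (m ℕ.* D)                                  ∎
      where
      open ≡-Reasoning
      remainder : suc (m ℕ.* D ℕ.+ i) ℕ.% D ≡ suc i
      remainder = trans (cong (λ z → suc z ℕ.% D) (ℕP.+-comm (m ℕ.* D) i))
                        (trans (DM.[m+kn]%n≡m%n (suc i) m D) (DM.m<n⇒m%n≡m 1+i<D))

  sumTo-multiples : ∀ (f : ℕ → ℤ) m → (∀ k → k ℕ.% D ≢ 0 → f k ≡ + 0) →
    sumTo f (m ℕ.* D) ≡ sumTo (λ j → f (j ℕ.* D)) m
  sumTo-multiples f zero    f-off = refl
  sumTo-multiples f (suc m) f-off = begin
    sumTo f (suc m ℕ.* D)                                    ≡⟨ cong (sumTo f) index ⟩
    sumTo f (m ℕ.* D ℕ.+ ℕ.pred D) + f (suc (m ℕ.* D ℕ.+ ℕ.pred D))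
      ≡⟨ cong₂ _+_ (sumTo-block f m f-off (ℕ.pred D) (subst (ℕ.pred D ℕ.<_) (ℕP.suc-pred D) (ℕP.n<1+n (ℕ.pred D)))) (cong f (sym index)) ⟩
    sumTo f (m ℕ.* D) + f (suc m ℕ.* D)
      ≡⟨ cong (_+ f (suc m ℕ.* D)) (sumTo-multiples f m f-off) ⟩
    sumTo (λ j → f (j ℕ.* D)) (suc m)                        ∎
    where
    open ≡-Reasoning
    index : suc m ℕ.* D ≡ suc (m ℕ.* D ℕ.+ ℕ.pred D)
    index = trans (cong (ℕ._+ m ℕ.* D) (sym (ℕP.suc-pred D))) (cong suc (ℕP.+-comm (ℕ.pred D) (m ℕ.* D)))

  spread-⊛ : ∀ a b → spread D (a ⊛ b) ≗ spread D a ⊛ spread D b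
  spread-⊛ a b n with n ℕ.% D ℕ.≟ 0
  ... | yes n%D≡0 = begin
    spread D (a ⊛ b) n                                   ≡⟨ cong (spread D (a ⊛ b)) n≡mD ⟩
    spread D (a ⊛ b) (m ℕ.* D)                           ≡⟨ spread-multiple (a ⊛ b) m ⟩
    sumTo (λ j → a j * b (m ∸ j)) m                      ≡⟨ sumTo-cong m (λ j → cong₂ _*_ (spread-multiple a j)
                                                              (trans (cong (spread D b) (sym (ℕP.*-distribʳ-∸ D m j))) (spread-multiple b (m ∸ j)))) ⟨
    sumTo (λ j → spread D a (j ℕ.* D) * spread D b (m ℕ.* D ∸ j ℕ.* D)) m
      ≡⟨ sumTo-multiples _ m (λ k k%D≢0 → trans (cong (_* spread D b (m ℕ.* D ∸ k)) (spread-off a k%D≢0))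
                                                (ℤP.*-zeroˡ (spread D b (m ℕ.* D ∸ k)))) ⟨
    (spread D a ⊛ spread D b) (m ℕ.* D)                  ≡⟨ cong (spread D a ⊛ spread D b) n≡mD ⟨
    (spread D a ⊛ spread D b) n                          ∎
    where
    open ≡-Reasoning
    m = n ℕ./ D
    n≡mD = divisible⇒multiple n n%D≡0
  ... | no n%D≢0 = trans (spread-off (a ⊛ b) n%D≢0) (sym (trans (sumTo-cong-≤ n vanishing) (sumTo-zero n)))
    where
    vanishing : ∀ k → k ℕ.≤ n → spread D a k * spread D b (n ∸ k) ≡ + 0
    vanishing k k≤n with k ℕ.% D ℕ.≟ 0
    ... | no  k%D≢0 = trans (cong (_* spread D b (n ∸ k)) (spread-off a k%D≢0)) (ℤP.*-zeroˡ (spread D b (n ∸ k)))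
    ... | yes k%D≡0 = trans (cong (spread D a k *_) (spread-off b [n∸k]%D≢0)) (ℤP.*-zeroʳ (spread D a k))
      where
      k≡jD = divisible⇒multiple k k%D≡0
      [n∸k]%D≢0 : (n ∸ k) ℕ.% D ≢ 0
      [n∸k]%D≢0 [n∸k]%D≡0 = n%D≢0 (trans (sym (trans (cong (λ z → (n ∸ z) ℕ.% D) k≡jD)
        (DM.m*n≤o⇒[o∸m*n]%n≡o%n (k ℕ./ D) (subst (ℕ._≤ n) k≡jD k≤n)))) [n∸k]%D≡0)

  spread-+ₚ : ∀ a b → spread D (a +ₚ b) ≗ spread D a +ₚ spread D b
  spread-+ₚ a b n with n ℕ.% D ≡ᵇ 0
  ... | true  = refl
  ... | false = refl

  spread--ₚ : ∀ a → spread D (-ₚ a) ≗ -ₚ spread D a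
  spread--ₚ a n with n ℕ.% D ≡ᵇ 0
  ... | true  = refl
  ... | false = refl

  spread-cong : ∀ {a b} → a ≗ b → spread D a ≗ spread D b
  spread-cong a≗b n with n ℕ.% D ≡ᵇ 0
  ... | true  = a≗b (n ℕ./ D)
  ... | false = refl

  spread-monomial : ∀ c k → spread D (monomial c k) ≗ monomial c (k ℕ.* D)
  spread-monomial c k n with n ℕ.% D ℕ.≟ 0
  ... | yes n%D≡0 = begin
    spread D (monomial c k) n                   ≡⟨ cong (spread D (monomial c k)) n≡mD ⟩
    spread D (monomial c k) (n ℕ./ D ℕ.* D)     ≡⟨ spread-multiple (monomial c k) (n ℕ./ D) ⟩
    monomial c k (n ℕ./ D)                      ≡⟨ stretch (n ℕ./ D) ⟩
    monomial c (k ℕ.* D) (n ℕ./ D ℕ.* D)        ≡⟨ cong (monomial c (k ℕ.* D)) n≡mD ⟨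
    monomial c (k ℕ.* D) n                      ∎
    where
    open ≡-Reasoning
    n≡mD = divisible⇒multiple n n%D≡0
    stretch : ∀ m → monomial c k m ≡ monomial c (k ℕ.* D) (m ℕ.* D)
    stretch m with m ℕ.≟ k
    ... | yes refl = trans (monomial-≡ c m) (sym (monomial-≡ c (m ℕ.* D)))
    ... | no  m≢k  = trans (monomial-≢ c (m≢k ∘ sym)) (sym (monomial-≢ c (λ kD≡mD → m≢k (sym (ℕP.*-cancelʳ-≡ k m D kD≡mD)))))
  ... | no n%D≢0 = trans (spread-off (monomial c k) n%D≢0)
                         (sym (monomial-≢ c (λ kD≡n → n%D≢0 (trans (cong (ℕ._% D) (sym kD≡n)) (DM.m*n%n≡0 k D)))))

  spread-oneP : spread D oneP ≗ oneP
  spread-oneP n = trans (spread-cong oneP≗x^0 n) (trans (spread-monomial (+ 1) 0 n) (sym (oneP≗x^0 n)))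

  spread-invPS : ∀ a → a 0 * a 0 ≡ + 1 → spread D (invPS a) ≗ invPS (spread D a)
  spread-invPS a a₀²≡1 = invPS-unique (spread D a) (spread D (invPS a))
    (trans (cong₂ _*_ (spread-multiple a 0) (spread-multiple a 0)) a₀²≡1) (λ n →
    trans (sym (spread-⊛ (invPS a) a n)) (trans (spread-cong (invPS-inverseˡ a a₀²≡1) n) (spread-oneP n)))

coeffAt-≡+ : ∀ L k {m} → k - val L ≡ + m → coeffAt L k ≡ ser L m
coeffAt-≡+ L k eq with k - val L | eq
... | + _ | refl = refl

coeffAt-≡- : ∀ L k {m} → k - val L ≡ -[1+ m ] → coeffAt L k ≡ + 0
coeffAt-≡- L k eq with k - val L | eq
... | -[1+ _ ] | refl = refl

coeffAt-cong : ∀ v {s s′} → s ≗ s′ → ∀ k → coeffAt (mkLS v s) k ≡ coeffAt (mkLS v s′) k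
coeffAt-cong v s≗s′ k with k - v
... | + m      = s≗s′ m
... | -[1+ _ ] = refl

coeffAt-val : ∀ L {v} → val L ≡ v → ∀ n → coeffAt L (v + + n) ≡ ser L n
coeffAt-val L {v} refl n = coeffAt-≡+ L (v + + n) (cancel v (+ n))
  where cancel : ∀ a b → a + b - a ≡ b
        cancel = ℤ-Solver.solve-∀

coeffAt-shifted : ∀ L {v} k → val L ≡ v + + k → ∀ n → coeffAt L (v + + n) ≡ (x^ k ⊛ ser L) n
coeffAt-shifted L {v} k refl n = by-cases (ℕP.≤-<-connex k n)
  where
  regroup : ∀ a b c → a + b - (a + c) ≡ b - c
  regroup = ℤ-Solver.solve-∀
  difference : v + + n - (v + + k) ≡ n ℤ.⊖ k
  difference = trans (regroup v (+ n) (+ k)) (ℤP.m-n≡m⊖n n k)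
  by-cases : k ℕ.≤ n ⊎ n ℕ.< k → coeffAt L (v + + n) ≡ (x^ k ⊛ ser L) n
  by-cases (inj₁ k≤n) = trans (coeffAt-≡+ L (v + + n) (trans difference (ℤP.⊖-≥ k≤n)))
                              (sym (trans (monomial-⊛-≤ (+ 1) (ser L) k≤n) (ℤP.*-identityˡ _)))
  by-cases (inj₂ n<k) = trans (coeffAt-≡- L (v + + n) (trans difference (trans (ℤP.⊖-< n<k)
                                 (cong (λ z → - + z) (ℕP.+-∸-assoc 1 n<k)))))
                              (sym (monomial-⊛-< (+ 1) (ser L) n<k))

private
  open Spread 288

  spread-difference : spread 288 G₂H₁-G₁H₂ ≗ ser (G 2 ⊗ H 1) +ₚ -ₚ (x^ 288 ⊛ ser (G 1 ⊗ H 2))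
  spread-difference = begin
    spread 288 (invPS a₂ ⊛ invPS b +ₚ -ₚ (x¹ ⊛ (invPS a ⊛ invPS b₂)))
      ≈⟨ spread-+ₚ (invPS a₂ ⊛ invPS b) (-ₚ (x¹ ⊛ (invPS a ⊛ invPS b₂))) ⟩
    spread 288 (invPS a₂ ⊛ invPS b) +ₚ spread 288 (-ₚ (x¹ ⊛ (invPS a ⊛ invPS b₂)))
      ≈⟨ +ₚ-cong (spread-inverses a₂ b refl refl) (spread--ₚ (x¹ ⊛ (invPS a ⊛ invPS b₂))) ⟩
    invPS (spread 288 a₂) ⊛ invPS (spread 288 b) +ₚ -ₚ spread 288 (x¹ ⊛ (invPS a ⊛ invPS b₂))
      ≈⟨ +ₚ-congˡ (invPS (spread 288 a₂) ⊛ invPS (spread 288 b)) (λ n → cong -_ (trans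
           (spread-⊛ x¹ (invPS a ⊛ invPS b₂) n) (⊛-cong (spread-monomial (+ 1) 1) (spread-inverses a b₂ refl refl) n))) ⟩
    ser (G 2 ⊗ H 1) +ₚ -ₚ (x^ 288 ⊛ ser (G 1 ⊗ H 2)) ∎
    where
    open ≗-Reasoning
    a = residueProduct 1 1
    a₂ = residueProduct 1 2
    b = residueProduct 5 1
    b₂ = residueProduct 5 2
    spread-inverses : ∀ c d → c 0 * c 0 ≡ + 1 → d 0 * d 0 ≡ + 1 →
                      spread 288 (invPS c ⊛ invPS d) ≗ invPS (spread 288 c) ⊛ invPS (spread 288 d)
    spread-inverses c d c₀²≡1 d₀²≡1 n =
      trans (spread-⊛ (invPS c) (invPS d) n) (⊛-cong (spread-invPS c c₀²≡1) (spread-invPS d d₀²≡1) n)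

  spread-etaQuotient : spread 288 etaQuotient ≗ ser (η 1 ⊗ η 4 ⊗ η 6 ⊗ invLS (η 2) ⊗ invLS (η 12 ⊗ η 12))
  spread-etaQuotient = begin
    spread 288 ((((E 1 ⊛ E 4) ⊛ E 6) ⊛ invPS (E 2)) ⊛ invPS (E 12 ⊛ E 12))
      ≈⟨ spread-⊛ (((E 1 ⊛ E 4) ⊛ E 6) ⊛ invPS (E 2)) (invPS (E 12 ⊛ E 12)) ⟩
    spread 288 (((E 1 ⊛ E 4) ⊛ E 6) ⊛ invPS (E 2)) ⊛ spread 288 (invPS (E 12 ⊛ E 12))
      ≈⟨ ⊛-cong (spread-⊛ ((E 1 ⊛ E 4) ⊛ E 6) (invPS (E 2))) (spread-invPS (E 12 ⊛ E 12) refl) ⟩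
    (spread 288 ((E 1 ⊛ E 4) ⊛ E 6) ⊛ spread 288 (invPS (E 2))) ⊛ invPS (spread 288 (E 12 ⊛ E 12))
      ≈⟨ ⊛-cong (⊛-cong (λ n → trans (spread-⊛ (E 1 ⊛ E 4) (E 6) n) (⊛-congʳ (spread 288 (E 6)) (spread-⊛ (E 1) (E 4)) n))
                        (spread-invPS (E 2) refl))
                (invPS-cong refl (spread-⊛ (E 12) (E 12))) ⟩
    (((spread 288 (E 1) ⊛ spread 288 (E 4)) ⊛ spread 288 (E 6)) ⊛ invPS (spread 288 (E 2)))
      ⊛ invPS (spread 288 (E 12) ⊛ spread 288 (E 12)) ∎
    where
    open ≗-Reasoning
    E = eulerProduct

mainTheorem14 : G 2 ⊗ H 1 ⊖ G 1 ⊗ H 2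
    ≈ η 1 ⊗ η 4 ⊗ η 6 ⊗ invLS (η 2) ⊗ invLS (η 12 ⊗ η 12)
mainTheorem14 = coeffAt-cong v series
  where
  -- Both sides start at x^(-180) = q^(-5/8).
  v = -[1+ 179 ]
  series : ser (G 2 ⊗ H 1 ⊖ G 1 ⊗ H 2) ≗ ser (η 1 ⊗ η 4 ⊗ η 6 ⊗ invLS (η 2) ⊗ invLS (η 12 ⊗ η 12))
  series n = begin
    coeffAt (G 2 ⊗ H 1) (v + + n) - coeffAt (G 1 ⊗ H 2) (v + + n)
      ≡⟨ cong₂ _-_ (coeffAt-val (G 2 ⊗ H 1) {v} refl n) (coeffAt-shifted (G 1 ⊗ H 2) {v} 288 refl n) ⟩
    (ser (G 2 ⊗ H 1) +ₚ -ₚ (x^ 288 ⊛ ser (G 1 ⊗ H 2))) n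
      ≡⟨ spread-difference n ⟨
    spread 288 G₂H₁-G₁H₂ n
      ≡⟨ spread-cong quotient-identity n ⟩
    spread 288 etaQuotient n
      ≡⟨ spread-etaQuotient n ⟩
    ser (η 1 ⊗ η 4 ⊗ η 6 ⊗ invLS (η 2) ⊗ invLS (η 12 ⊗ η 12)) n ∎
    where open ≡-Reasoning
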